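{- Let $n\ge 1$, $N=2n$, and let $T$ be a rotationally symmetric standard Young tableau of shape $2\times n$. Then the $2$-web of the folded tableau $F(T)$ equals the web obtained by folding the $2$-web of $T$ to the right with respect to its axis of symmetry, i.e. $\mathcal{W}_{F(T)} = F(\mathcal{W}_T)$.
   Context: For a partition $\lambda$ with $N$ boxes, $\mathrm{SYT}(\lambda)$ is the set of standard Young tableaux of shape $\lambda$ with entries $1,\dots,N$. For a tableau $T$ and integer $k$, $T_{\le k}$ is the subtableau of entries $\le k$. Promotion $P:\mathrm{SYT}(\lambda)\to\mathrm{SYT}(\lambda)$: delete the entry $1$, leaving an empty box; repeatedly slide into the empty box the smaller of the entries immediately to its right and immediately below it (whichever exist) until neither exists; subtract $1$ from all entries; put $N$ in the empty box. For $k=1,\dots,N$, $P_k(T)$ is obtained by applying promotion to $T_{\le k}$ (a standard tableau of straight shape with entries $1,\dots,k$) and leaving entries $>k$ unchanged. Evacuation is $E=P_1\circ P_2\circ\cdots\circ P_N$; $T$ is self-evacuating if $E(T)=T$. For a rectangular shape, $T$ is called rotationally symmetric if it is self-evacuating, equivalently if any two entries in boxes that are opposite under $180^\circ$ rotation sum to $N+1$. For $j=1,\dots,\lfloor N/2\rfloor$ let $f^j=P_{N-2j+2}\circ P_{N-2j+4}\circ\cdots\circ P_N$, and define folding $F=f^{\lfloor N/2\rfloor}$. A $2$-web on $N=2n$ vertices is a perfect matching of $\{1,\dots,N\}$ drawn as non-crossing undirected arcs above a horizontal line with vertices $1,\dots,N$ from left to right. For $T\in\mathrm{SYT}(n,n)$,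 $\mathcal{W}_T$ is the unique $2$-web in which the entries of the first row of $T$ are exactly the left endpoints of arcs and the entries of the second row are exactly the right endpoints. A $2$-web is symmetric if it is invariant under $k\mapsto N+1-k$. Write $\bar{k}=N+1-k$. For a symmetric $2$-web $\mathcal{W}$, $F(\mathcal{W})$ is the $2$-web with the following arcs: whenever $\{a,b\}$ and $\{\bar a,\bar b\}$ are arcs of $\mathcal{W}$ with $a<b\le n$, $F(\mathcal{W})$ has arcs $\{N+1-2a,\ N+2-2b\}$ and $\{N+2-2a,\ N+1-2b\}$; whenever $\{a,\bar a\}$ is an arc of $\mathcal{W}$ with $a\le n$, $F(\mathcal{W})$ has the arc $\{N+1-2a,\ N+2-2a\}$. -}

module Defs where

open import Data.Nat using (ℕ; zero; suc; pred; _+_; _*_; _∸_; _≤_; _<_; _≤?_; _<ᵇ_)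
open import Data.Bool using (if_then_else_)
open import Data.List using (List; []; _∷_; _++_; [_]; map; filter; length; upTo)
open import Data.List.Membership.Propositional using (_∈_)
open import Data.List.Relation.Unary.Linked using (Linked)
open import Data.List.Relation.Binary.Pointwise using (Pointwise)
open import Data.List.Relation.Binary.Permutation.Propositional using (_↭_)
open import Data.Product using (_×_; _,_; proj₁; proj₂; ∃-syntax)
open import Data.Sum using (_⊎_)
open import Data.Empty using (⊥)
open import Relation.Nullary.Decidable using (¬?)
open import Relation.Binary.PropositionalEquality using (_≡_)
open import Function.Bundles using (_⇔_)

record Tab : Set where
  constructor mkTab
  field
    row1 : List ℕ
    row2 : List ℕ
open Tab public

record IsSYT (n : ℕ) (T : Tab) : Set where
  field
    len1   : length (row1 T) ≡ n
    cols   : Pointwise _<_ (row1 T) (row2 T)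
    rowInc1 : Linked _<_ (row1 T)
    rowInc2 : Linked _<_ (row2 T)
    entries : row1 T ++ row2 T ↭ map suc (upTo (2 * n))

-- Jeu de taquin slide of the empty box in a two-row tableau.
-- xs : entries of row 1 strictly to the right of the empty box,
-- ys : entries of row 2 from the column of the empty box on,
-- v  : value put in the box where the empty box finally stops.
-- Returns the new row-1 part (from the column of the empty box on) and
-- the new row-2 part (from that column on).

slide : List ℕ → List ℕ → ℕ → List ℕ × List ℕ
slide []       []       v = [ v ] , []
slide []       (y ∷ ys) v = [ y ] , ys ++ [ v ]
slide (x ∷ xs) []       v = x ∷ xs ++ [ v ] , []
slide (x ∷ xs) (y ∷ ys) v =
  if y <ᵇ x
  then (y ∷ x ∷ xs , ys ++ [ v ])
  else (x ∷ proj₁ (slide xs ys v) , y ∷ proj₂ (slide xs ys v))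

promote : ℕ → Tab → Tab
promote k (mkTab []       r2) = mkTab [] r2
promote k (mkTab (_ ∷ xs) r2) =
  mkTab (proj₁ (slide (map pred xs) (map pred r2) k))
        (proj₂ (slide (map pred xs) (map pred r2) k))

restrict : ℕ → Tab → Tab
restrict k (mkTab r1 r2) = mkTab (filter (_≤? k) r1) (filter (_≤? k) r2)

above : ℕ → List ℕ → List ℕ
above k = filter (λ x → ¬? (x ≤? k))

P : ℕ → Tab → Tab
P k T = mkTab (row1 S ++ above k (row1 T)) (row2 S ++ above k (row2 T))
  where S = promote k (restrict k T)

evacFrom : ℕ → Tab → Tab
evacFrom zero    T = T
evacFrom (suc m) T = evacFrom m (P (suc m) T)

E : ℕ → Tab → Tab
E N = evacFrom N

-- rotationally symmetric = self-evacuating (N = 2n).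
RotSym : ℕ → Tab → Set
RotSym n T = E (2 * n) T ≡ T

foldFrom : ℕ → Tab → Tab
foldFrom zero    T = T
foldFrom (suc m) T = foldFrom m (P (2 * suc m) T)

F : ℕ → Tab → Tab
F n = foldFrom n

-- 2-webs on N vertices: a set of arcs, R i j meaning the arc {i,j} with i < j.

Web : Set₁
Web = ℕ → ℕ → Set

Partner : Web → ℕ → ℕ → Set
Partner R v w = R v w ⊎ R w v

record Is2Web (N : ℕ) (R : Web) : Set where
  field
    arcBounds : ∀ i j → R i j → 1 ≤ i × i < j × j ≤ N
    covers    : ∀ v → 1 ≤ v → v ≤ N → ∃[ w ] Partner R v w
    unique    : ∀ v w w′ → Partner R v w → Partner R v w′ → w ≡ w′
    nonCross  : ∀ a b c d → R a b → R c d → a < c → c < b → b < d → ⊥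

record IsWebOf (n : ℕ) (T : Tab) (R : Web) : Set where
  field
    isWeb : Is2Web (2 * n) R
    left  : ∀ v → (v ∈ row1 T) ⇔ (∃[ w ] R v w)
    right : ∀ v → (v ∈ row2 T) ⇔ (∃[ w ] R w v)

foldW : ℕ → Web → Web
foldW n R x y =
  (∃[ a ] ∃[ b ] (a < b × b ≤ n × R a b × R (N + 1 ∸ b) (N + 1 ∸ a)
     × ((x ≡ N + 2 ∸ 2 * b × y ≡ N + 1 ∸ 2 * a)
        ⊎ (x ≡ N + 1 ∸ 2 * b × y ≡ N + 2 ∸ 2 * a))))
  ⊎ (∃[ a ] (a ≤ n × R a (N + 1 ∸ a)
       × x ≡ N + 1 ∸ 2 * a × y ≡ N + 2 ∸ 2 * a))
  where N = 2 * n

-- Encode T ∈ SYT(n,n) by its Yamanouchi word w (letter i is true iff i lies in the first row),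
-- a balanced ballot word.  On ballot words promotion deletes the first letter, rectifies the
-- rest (its unmatched closing letter becomes opening) and appends one letter, so P_k,
-- evacuation and folding become explicit word operations.  Evacuation of a balanced ballot word
-- is its reverse complement, so rotational symmetry of T says that w is self-complementary.
-- The web of T is the bracket matching of w: {a, b} is an arc iff a opens, b closes and the
-- letters strictly between them form a Dyck word; hence the web is mirror symmetric.  Finally,
-- the letters 2i and 2i+1 of the folded word are read off the window of w between the mirror
-- vertices n - i and n + 1 + i, and the three possible shapes of the arc at n - i (right
-- endpoint, arc to its mirror, arc to a vertex ≤ n) show that F(T) has exactly the left and
-- right endpoints of the folded web.
module Submission where

open import Data.Bool using (Bool; true; false; not; T; if_then_else_)
open import Data.Unit using (⊤; tt)
open import Data.Empty using (⊥; ⊥-elim)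
open import Data.Nat using (ℕ; zero; suc; pred; _+_; _*_; _∸_; _≤_; _<_; _⊓_; _<ᵇ_; _≤?_; z≤n; s≤s)
open import Data.Nat.Properties
open import Data.Nat.Tactic.RingSolver using (solve-∀)
open import Data.List using (List; []; _∷_; _++_; [_]; length; take; drop; map; filter; reverse; upTo; applyUpTo)
import Data.List.Properties as LP
open import Data.List.Properties using (++-assoc; length-++; take++drop≡id; ∷-injectiveʳ; ∷-injectiveˡ; ++-identityʳ)
open import Data.List.Membership.Propositional using (_∈_)
open import Data.List.Relation.Unary.Any using (here; there)
open import Data.List.Relation.Unary.All as All using (All; []; _∷_)
open import Data.List.Relation.Unary.AllPairs using (AllPairs; []; _∷_)
open import Data.List.Relation.Unary.Linked as Linked using (Linked; []; [-]; _∷_)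
open import Data.List.Relation.Unary.Sorted.TotalOrder.Properties using (↗↭↗⇒≋)
open import Data.List.Relation.Binary.Pointwise as Pointwise using (Pointwise; []; _∷_)
open import Data.List.Relation.Binary.Permutation.Propositional using (_↭_; ↭-sym; ↭-trans; ↭-refl; prep; ↭⇒↭ₛ)
open import Data.List.Relation.Binary.Permutation.Propositional.Properties using (shift)
open import Data.Product using (_×_; _,_; proj₁; proj₂; ∃-syntax)
open import Data.Sum using (_⊎_; inj₁; inj₂)
open import Relation.Nullary.Decidable using (¬?)
open import Relation.Binary.Definitions using (tri<; tri≈; tri>)
open import Relation.Binary.PropositionalEquality hiding ([_])
open import Function.Bundles using (Equivalence; mk⇔)
open import Defs

true≢false : true ≢ false
true≢false ()

take-length-++ : ∀ {A : Set} (u v : List A) → take (length u) (u ++ v) ≡ u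
take-length-++ [] v = refl
take-length-++ (x ∷ u) v = cong (x ∷_) (take-length-++ u v)

drop-length-++ : ∀ {A : Set} (u v : List A) → drop (length u) (u ++ v) ≡ v
drop-length-++ [] v = refl
drop-length-++ (x ∷ u) v = drop-length-++ u v

take-++-length : ∀ {A : Set} (u v : List A) k → length u ≡ k → take k (u ++ v) ≡ u
take-++-length u v k refl = take-length-++ u v

length-take-≤ : ∀ {A : Set} k (xs : List A) → k ≤ length xs → length (take k xs) ≡ k
length-take-≤ k xs le = trans (LP.length-take k xs) (m≤n⇒m⊓n≡m le)

drop-suc-∷ : ∀ {A : Set} c (ys : List A) z zs → drop c ys ≡ z ∷ zs → drop (suc c) ys ≡ zs
drop-suc-∷ zero (y ∷ ys) z zs refl = refl
drop-suc-∷ (suc c) (y ∷ ys) z zs e = drop-suc-∷ c ys z zs e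

++-prefix-≡ : ∀ {A : Set} (a b c d : List A) → a ++ b ≡ c ++ d → length a ≡ length c → a ≡ c
++-prefix-≡ [] b [] d e l = refl
++-prefix-≡ (x ∷ a) b (y ∷ c) d e l = cong₂ _∷_ (∷-injectiveˡ e) (++-prefix-≡ a b c d (∷-injectiveʳ e) (suc-injective l))

snoc-view : ∀ {A : Set} (B : List A) d → length B ≡ suc d → ∃[ B' ] ∃[ b ] (B ≡ B' ++ [ b ] × length B' ≡ d)
snoc-view (x ∷ []) zero _ = [] , x , refl , refl
snoc-view (x ∷ y ∷ B) (suc d) e with snoc-view (y ∷ B) d (suc-injective e)
... | B' , b , e' , l = x ∷ B' , b , cong (x ∷_) e' , cong suc l
snoc-view (x ∷ []) (suc d) ()
snoc-view (x ∷ y ∷ B) zero ()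


≡+⇒∸≡ : ∀ {x y z} → x ≡ y + z → x ∸ y ≡ z
≡+⇒∸≡ {y = y} {z} refl = m+n∸m≡n y z


module BallotWord where

  -- Read the word with c unmatched opening letters (true) already seen: rectify turns every
  -- unmatched closing letter (false) into an opening one, height is the final number of
  -- unmatched opening letters, and hitsFloor tells whether some closing letter was unmatched.
  rectify : ℕ → List Bool → List Bool
  rectify c [] = []
  rectify c (true ∷ t) = true ∷ rectify (suc c) t
  rectify zero (false ∷ t) = true ∷ rectify zero t
  rectify (suc c) (false ∷ t) = false ∷ rectify c t

  height : ℕ → List Bool → ℕ
  height c [] = c
  height c (true ∷ t) = height (suc c) t
  height zero (false ∷ t) = height zero t
  height (suc c) (false ∷ t) = height c t

  hitsFloor : ℕ → List Bool → Bool
  hitsFloor c [] = false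
  hitsFloor c (true ∷ t) = hitsFloor (suc c) t
  hitsFloor zero (false ∷ t) = true
  hitsFloor (suc c) (false ∷ t) = hitsFloor c t

  promotedLetter : List Bool → Bool
  promotedLetter [] = true
  promotedLetter (true ∷ t) = not (hitsFloor 0 t)
  promotedLetter (false ∷ t) = true

  promoteWord : List Bool → List Bool
  promoteWord [] = []
  promoteWord (_ ∷ t) = rectify 0 t ++ [ not (hitsFloor 0 t) ]

  promoteWordAt : ℕ → List Bool → List Bool
  promoteWordAt k w = promoteWord (take k w) ++ drop k w

  evacWord : List Bool → List Bool
  evacWord [] = []
  evacWord (h ∷ t) = evacWord t ++ [ promotedLetter (h ∷ t) ]

  inner : ℕ → List Bool → List Bool
  inner m s = take (2 * m) (drop 1 s)

  foldWord : ℕ → List Bool → List Bool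
  foldWord zero s = []
  foldWord (suc m) s =
    foldWord m (inner m s) ++ rectify (height 0 (inner m s)) (drop (suc (2 * m)) s) ++ [ promotedLetter s ]

  length-rectify : ∀ c t → length (rectify c t) ≡ length t
  length-rectify c [] = refl
  length-rectify c (true ∷ t) = cong suc (length-rectify (suc c) t)
  length-rectify zero (false ∷ t) = cong suc (length-rectify zero t)
  length-rectify (suc c) (false ∷ t) = cong suc (length-rectify c t)

  rectify-++ : ∀ c u v → rectify c (u ++ v) ≡ rectify c u ++ rectify (height c u) v
  rectify-++ c [] v = refl
  rectify-++ c (true ∷ u) v = cong (true ∷_) (rectify-++ (suc c) u v)
  rectify-++ zero (false ∷ u) v = cong (true ∷_) (rectify-++ zero u v)
  rectify-++ (suc c) (false ∷ u) v = cong (false ∷_) (rectify-++ c u v)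

  height-++ : ∀ c u v → height c (u ++ v) ≡ height (height c u) v
  height-++ c [] v = refl
  height-++ c (true ∷ u) v = height-++ (suc c) u v
  height-++ zero (false ∷ u) v = height-++ zero u v
  height-++ (suc c) (false ∷ u) v = height-++ c u v

  rectify-rectify : ∀ c d t → rectify c (rectify d t) ≡ rectify (c ⊓ d) t
  rectify-rectify c d [] = refl
  rectify-rectify c d (true ∷ t) = cong (true ∷_) (rectify-rectify (suc c) (suc d) t)
  rectify-rectify zero zero (false ∷ t) = cong (true ∷_) (rectify-rectify 1 0 t)
  rectify-rectify (suc c) zero (false ∷ t) = cong (true ∷_) (rectify-rectify (suc (suc c)) 0 t)
  rectify-rectify zero (suc d) (false ∷ t) = cong (true ∷_) (rectify-rectify 0 d t)
  rectify-rectify (suc c) (suc d) (false ∷ t) = cong (false ∷_) (rectify-rectify c d t)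

  hitsFloor-rectify-lower : ∀ c d t → d ≤ c → hitsFloor c (rectify d t) ≡ false
  hitsFloor-rectify-lower c d [] _ = refl
  hitsFloor-rectify-lower c d (true ∷ t) le = hitsFloor-rectify-lower (suc c) (suc d) t (s≤s le)
  hitsFloor-rectify-lower c zero (false ∷ t) le = hitsFloor-rectify-lower (suc c) 0 t z≤n
  hitsFloor-rectify-lower (suc c) (suc d) (false ∷ t) (s≤s le) = hitsFloor-rectify-lower c d t le

  hitsFloor-rectify-higher : ∀ c d t → c < d → hitsFloor c (rectify d t) ≡ hitsFloor c t
  hitsFloor-rectify-higher c d [] _ = refl
  hitsFloor-rectify-higher c d (true ∷ t) lt = hitsFloor-rectify-higher (suc c) (suc d) t (s≤s lt)
  hitsFloor-rectify-higher zero (suc d) (false ∷ t) lt = refl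
  hitsFloor-rectify-higher (suc c) (suc d) (false ∷ t) (s≤s lt) = hitsFloor-rectify-higher c d t lt

  promoteWord-rectify : ∀ h t → promoteWord (rectify 0 (h ∷ t)) ≡ rectify 0 t ++ [ promotedLetter (h ∷ t) ]
  promoteWord-rectify true t rewrite rectify-rectify 0 1 t | hitsFloor-rectify-higher 0 1 t (s≤s z≤n) = refl
  promoteWord-rectify false t rewrite rectify-rectify 0 0 t | hitsFloor-rectify-lower 0 0 t z≤n = refl

  promoteWordAt-rectify-++ : ∀ k s r → length s ≡ k → promoteWordAt k (rectify 0 s ++ r) ≡ promoteWord (rectify 0 s) ++ r
  promoteWordAt-rectify-++ k s r refl =
    cong₂ (λ a b → promoteWord a ++ b)
      (take-++-length (rectify 0 s) r (length s) (length-rectify 0 s))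
      (subst (λ z → drop z (rectify 0 s ++ r) ≡ r) (length-rectify 0 s) (drop-length-++ (rectify 0 s) r))

  promoteWordAt-fold-step : ∀ m s r → length s ≡ 2 * suc m → promoteWordAt (2 * suc m) (rectify 0 s ++ r) ≡
     rectify 0 (inner m s) ++ (rectify (height 0 (inner m s)) (drop (suc (2 * m)) s) ++ (promotedLetter s ∷ r))
  promoteWordAt-fold-step m [] r ()
  promoteWordAt-fold-step m (h ∷ t) r len = begin
      promoteWordAt (2 * suc m) (rectify 0 (h ∷ t) ++ r)
    ≡⟨ promoteWordAt-rectify-++ _ (h ∷ t) r len ⟩
      promoteWord (rectify 0 (h ∷ t)) ++ r
    ≡⟨ cong (λ z → z ++ r) (promoteWord-rectify h t) ⟩
      (rectify 0 t ++ [ promotedLetter (h ∷ t) ]) ++ r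
    ≡⟨ cong (λ z → (rectify 0 z ++ [ promotedLetter (h ∷ t) ]) ++ r) (sym (take++drop≡id (2 * m) t)) ⟩
      (rectify 0 (M ++ L) ++ [ promotedLetter (h ∷ t) ]) ++ r
    ≡⟨ cong (λ z → (z ++ [ promotedLetter (h ∷ t) ]) ++ r) (rectify-++ 0 M L) ⟩
      ((rectify 0 M ++ rectify (height 0 M) L) ++ [ promotedLetter (h ∷ t) ]) ++ r
    ≡⟨ trans (++-assoc (rectify 0 M ++ rectify (height 0 M) L) _ r) (++-assoc (rectify 0 M) _ _) ⟩
      rectify 0 M ++ (rectify (height 0 M) L ++ (promotedLetter (h ∷ t) ∷ r)) ∎
    where
    open ≡-Reasoning
    M = take (2 * m) t
    L = drop (2 * m) t

  length-inner : ∀ m s → length s ≡ 2 * suc m → length (inner m s) ≡ 2 * m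
  length-inner m [] ()
  length-inner m (h ∷ t) len = length-take-≤ (2 * m) t (subst (2 * m ≤_) (sym (suc-injective len)) (+-monoʳ-≤ m (n≤1+n (m + 0))))

  foldWord-suc-++ : ∀ m s r →
      foldWord (suc m) s ++ r ≡ foldWord m (inner m s) ++ (rectify (height 0 (inner m s)) (drop (suc (2 * m)) s) ++ (promotedLetter s ∷ r))
  foldWord-suc-++ m s r =
    trans (++-assoc (foldWord m (inner m s)) _ r) (cong (foldWord m (inner m s) ++_) (++-assoc (rectify (height 0 (inner m s)) (drop (suc (2 * m)) s)) _ r))

  promoteWordAt-evac-step : ∀ h t r → promoteWordAt (suc (length t)) (rectify 0 (h ∷ t) ++ r) ≡ rectify 0 t ++ (promotedLetter (h ∷ t) ∷ r)
  promoteWordAt-evac-step h t r =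
    trans (promoteWordAt-rectify-++ _ (h ∷ t) r refl) (trans (cong (_++ r) (promoteWord-rectify h t)) (++-assoc (rectify 0 t) _ r))


module Slide where

  open BallotWord

  Labelled : Set
  Labelled = List (ℕ × Bool)

  letters : Labelled → List Bool
  letters = map proj₂

  firstRow : Labelled → List ℕ
  firstRow [] = []
  firstRow ((x , true) ∷ L) = x ∷ firstRow L
  firstRow ((x , false) ∷ L) = firstRow L

  secondRow : Labelled → List ℕ
  secondRow [] = []
  secondRow ((x , true) ∷ L) = secondRow L
  secondRow ((x , false) ∷ L) = x ∷ secondRow L

  rows : Labelled → List ℕ × List ℕ
  rows L = firstRow L , secondRow L

  rectifyL : ℕ → Labelled → Labelled
  rectifyL c [] = []
  rectifyL c ((x , true) ∷ L) = (x , true) ∷ rectifyL (suc c) L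
  rectifyL zero ((x , false) ∷ L) = (x , true) ∷ rectifyL zero L
  rectifyL (suc c) ((x , false) ∷ L) = (x , false) ∷ rectifyL c L

  Increasing : Labelled → Set
  Increasing = AllPairs (λ p q → proj₁ p < proj₁ q)

  firstRow-++ : ∀ L M → firstRow (L ++ M) ≡ firstRow L ++ firstRow M
  firstRow-++ [] M = refl
  firstRow-++ ((x , true) ∷ L) M = cong (x ∷_) (firstRow-++ L M)
  firstRow-++ ((x , false) ∷ L) M = firstRow-++ L M

  secondRow-++ : ∀ L M → secondRow (L ++ M) ≡ secondRow L ++ secondRow M
  secondRow-++ [] M = refl
  secondRow-++ ((x , true) ∷ L) M = secondRow-++ L M
  secondRow-++ ((x , false) ∷ L) M = cong (x ∷_) (secondRow-++ L M)

  firstRow-All : ∀ {P : ℕ → Set} L → All (λ q → P (proj₁ q)) L → All P (firstRow L)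
  firstRow-All [] _ = []
  firstRow-All ((x , true) ∷ L) (p ∷ ps) = p ∷ firstRow-All L ps
  firstRow-All ((x , false) ∷ L) (p ∷ ps) = firstRow-All L ps

  secondRow-All : ∀ {P : ℕ → Set} L → All (λ q → P (proj₁ q)) L → All P (secondRow L)
  secondRow-All [] _ = []
  secondRow-All ((x , true) ∷ L) (p ∷ ps) = secondRow-All L ps
  secondRow-All ((x , false) ∷ L) (p ∷ ps) = p ∷ secondRow-All L ps

  letters-++ : ∀ L M → letters (L ++ M) ≡ letters L ++ letters M
  letters-++ = LP.map-++ proj₂

  rectifyL-stable : ∀ c L → rectify c (letters L) ≡ letters L → rectifyL c L ≡ L
  rectifyL-stable c [] _ = refl
  rectifyL-stable c ((x , true) ∷ L) e = cong ((x , true) ∷_) (rectifyL-stable (suc c) L (∷-injectiveʳ e))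
  rectifyL-stable zero ((x , false) ∷ L) ()
  rectifyL-stable (suc c) ((x , false) ∷ L) e = cong ((x , false) ∷_) (rectifyL-stable c L (∷-injectiveʳ e))

  AllFirst : Labelled → Set
  AllFirst = All (λ p → proj₂ p ≡ true)

  data FirstSecondRow (L : Labelled) : Set where
    none : AllFirst L → FirstSecondRow L
    atSecond : ∀ A y B → AllFirst A → L ≡ A ++ (y , false) ∷ B → FirstSecondRow L

  firstSecondRow : ∀ L → FirstSecondRow L
  firstSecondRow [] = none []
  firstSecondRow ((x , false) ∷ L) = atSecond [] x L [] refl
  firstSecondRow ((x , true) ∷ L) with firstSecondRow L
  ... | none a = none (refl ∷ a)
  ... | atSecond A y B a e = atSecond ((x , true) ∷ A) y B (refl ∷ a) (cong ((x , true) ∷_) e)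

  secondRow-AllFirst : ∀ A → AllFirst A → secondRow A ≡ []
  secondRow-AllFirst [] _ = refl
  secondRow-AllFirst ((x , .true) ∷ A) (refl ∷ a) = secondRow-AllFirst A a

  rectifyL-AllFirst : ∀ c A → AllFirst A → rectifyL c A ≡ A
  rectifyL-AllFirst c [] _ = refl
  rectifyL-AllFirst c ((x , .true) ∷ A) (refl ∷ a) = cong ((x , true) ∷_) (rectifyL-AllFirst (suc c) A a)

  hitsFloor-AllFirst : ∀ c A → AllFirst A → hitsFloor c (letters A) ≡ false
  hitsFloor-AllFirst c [] _ = refl
  hitsFloor-AllFirst c ((x , .true) ∷ A) (refl ∷ a) = hitsFloor-AllFirst (suc c) A a

  rectifyL-AllFirst-++ : ∀ c A M → AllFirst A → rectifyL c (A ++ M) ≡ A ++ rectifyL (length A + c) M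
  rectifyL-AllFirst-++ c [] M _ = refl
  rectifyL-AllFirst-++ c ((x , .true) ∷ A) M (refl ∷ a) =
    cong ((x , true) ∷_) (trans (rectifyL-AllFirst-++ (suc c) A M a) (cong (λ z → A ++ rectifyL z M) (+-suc (length A) c)))

  rectify-AllFirst-++ : ∀ c A M → AllFirst A → rectify c (letters (A ++ M)) ≡ letters A ++ rectify (length A + c) (letters M)
  rectify-AllFirst-++ c [] M _ = refl
  rectify-AllFirst-++ c ((x , .true) ∷ A) M (refl ∷ a) =
    cong (true ∷_) (trans (rectify-AllFirst-++ (suc c) A M a) (cong (λ z → letters A ++ rectify z (letters M)) (+-suc (length A) c)))

  hitsFloor-AllFirst-++ : ∀ c A M → AllFirst A → hitsFloor c (letters (A ++ M)) ≡ hitsFloor (length A + c) (letters M)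
  hitsFloor-AllFirst-++ c [] M _ = refl
  hitsFloor-AllFirst-++ c ((x , .true) ∷ A) M (refl ∷ a) =
    trans (hitsFloor-AllFirst-++ (suc c) A M a) (cong (λ z → hitsFloor z (letters M)) (+-suc (length A) c))

  All-remove : ∀ {P : ℕ × Bool → Set} A y B → All P (A ++ y ∷ B) → All P (A ++ B)
  All-remove [] y B (_ ∷ ps) = ps
  All-remove (x ∷ A) y B (p ∷ ps) = p ∷ All-remove A y B ps

  Increasing-remove : ∀ A y B → Increasing (A ++ y ∷ B) → Increasing (A ++ B)
  Increasing-remove [] y B (_ ∷ i) = i
  Increasing-remove (x ∷ A) y B (a ∷ i) = All-remove A y B a ∷ Increasing-remove A y B i

  All-middle : ∀ {P : ℕ × Bool → Set} A y B → All P (A ++ y ∷ B) → P y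
  All-middle [] y B (p ∷ _) = p
  All-middle (x ∷ A) y B (_ ∷ ps) = All-middle A y B ps

  length-remove : ∀ (A : Labelled) y B → length (A ++ B) < length (A ++ y ∷ B)
  length-remove [] y B = ≤-refl
  length-remove (x ∷ A) y B = s≤s (length-remove A y B)

  slide-below-first : ∀ y xs ys v → All (y <_) xs → slide xs (y ∷ ys) v ≡ (y ∷ xs , ys ++ [ v ])
  slide-below-first y [] ys v _ = refl
  slide-below-first y (x ∷ xs) ys v (p ∷ _) with y <ᵇ x in eq
  ... | true = refl
  ... | false = ⊥-elim (subst T eq (<⇒<ᵇ p))

  slide-right-first : ∀ x y xs ys v → x < y →
    slide (x ∷ xs) (y ∷ ys) v ≡ (x ∷ proj₁ (slide xs ys v) , y ∷ proj₂ (slide xs ys v))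
  slide-right-first x y xs ys v lt with y <ᵇ x in eq
  ... | false = refl
  ... | true = ⊥-elim (<-asym lt (<ᵇ⇒< y x (subst T (sym eq) tt)))

  slideResult : Labelled → ℕ → Labelled
  slideResult L v = rectifyL 0 L ++ [ (v , not (hitsFloor 0 (letters L))) ]

  -- The box moves right past x, above y; the rest of the slide is the slide of the labelled
  -- word with x and y deleted.
  slide-past-first : ∀ x A y B v → x < y → AllFirst A →
    slide (firstRow (A ++ B)) (secondRow (A ++ B)) v ≡ rows (slideResult (A ++ B) v) →
    slide (firstRow ((x , true) ∷ A ++ (y , false) ∷ B)) (secondRow ((x , true) ∷ A ++ (y , false) ∷ B)) v
      ≡ rows (slideResult ((x , true) ∷ A ++ (y , false) ∷ B) v)
  slide-past-first x A y B v x<y allA slide-A++B = begin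
      slide (firstRow ((x , true) ∷ A ++ (y , false) ∷ B)) (secondRow ((x , true) ∷ A ++ (y , false) ∷ B)) v
    ≡⟨ cong₂ (λ p q → slide (x ∷ p) q v) (firstRow-++ A ((y , false) ∷ B)) secondRows ⟩
      slide (x ∷ firstRow A ++ firstRow B) (y ∷ secondRow B) v
    ≡⟨ slide-right-first x y _ _ v x<y ⟩
      (x ∷ proj₁ S , y ∷ proj₂ S)
    ≡⟨ cong (λ R → x ∷ proj₁ R , y ∷ proj₂ R) slide-S ⟩
      (x ∷ firstRow (A ++ rest) , y ∷ secondRow (A ++ rest))
    ≡⟨ cong₂ (λ p q → x ∷ p , y ∷ q) (firstRow-++ A rest) (secondRow-++ A rest) ⟩
      (x ∷ firstRow A ++ firstRow rest , y ∷ secondRow A ++ secondRow rest)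
    ≡⟨ cong₂ (λ p q → x ∷ p , q) (sym (firstRow-++ A ((y , false) ∷ rest)))
         (trans (cong (λ z → y ∷ z ++ secondRow rest) (secondRow-AllFirst A allA)) (sym secondRows-rest)) ⟩
      rows ((x , true) ∷ A ++ (y , false) ∷ rest)
    ≡⟨ cong rows (sym result) ⟩
      rows (slideResult ((x , true) ∷ A ++ (y , false) ∷ B) v) ∎
    where
    open ≡-Reasoning
    S = slide (firstRow A ++ firstRow B) (secondRow B) v
    rest : Labelled
    rest = rectifyL (length A + 0) B ++ [ (v , not (hitsFloor (length A + 0) (letters B))) ]
    secondRows : secondRow (A ++ (y , false) ∷ B) ≡ y ∷ secondRow B
    secondRows = trans (secondRow-++ A _) (cong (_++ y ∷ secondRow B) (secondRow-AllFirst A allA))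
    secondRows-rest : secondRow (A ++ (y , false) ∷ rest) ≡ y ∷ secondRow rest
    secondRows-rest = trans (secondRow-++ A _) (cong (_++ y ∷ secondRow rest) (secondRow-AllFirst A allA))
    slide-S : S ≡ rows (A ++ rest)
    slide-S = begin
        S
      ≡⟨ cong₂ (λ p q → slide p q v) (sym (firstRow-++ A B))
           (sym (trans (secondRow-++ A B) (cong (_++ secondRow B) (secondRow-AllFirst A allA)))) ⟩
        slide (firstRow (A ++ B)) (secondRow (A ++ B)) v
      ≡⟨ slide-A++B ⟩
        rows (slideResult (A ++ B) v)
      ≡⟨ cong rows (cong₂ (λ R h → R ++ [ (v , not h) ]) (rectifyL-AllFirst-++ 0 A B allA) (hitsFloor-AllFirst-++ 0 A B allA)) ⟩
        rows ((A ++ rectifyL (length A + 0) B) ++ _)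
      ≡⟨ cong rows (++-assoc A _ _) ⟩
        rows (A ++ rest) ∎
    result : slideResult ((x , true) ∷ A ++ (y , false) ∷ B) v ≡ (x , true) ∷ A ++ (y , false) ∷ rest
    result = cong ((x , true) ∷_) (begin
        rectifyL 1 (A ++ (y , false) ∷ B) ++ _
      ≡⟨ cong₂ (λ R h → R ++ [ (v , not h) ]) (rectifyL-AllFirst-++ 1 A _ allA) (hitsFloor-AllFirst-++ 1 A _ allA) ⟩
        (A ++ rectifyL (length A + 1) ((y , false) ∷ B)) ++ [ (v , not (hitsFloor (length A + 1) (letters ((y , false) ∷ B)))) ]
      ≡⟨ cong (λ z → (A ++ rectifyL z ((y , false) ∷ B)) ++ [ (v , not (hitsFloor z (letters ((y , false) ∷ B)))) ]) (+-suc (length A) 0) ⟩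
        (A ++ (y , false) ∷ rectifyL (length A + 0) B) ++ _
      ≡⟨ ++-assoc A _ _ ⟩
        A ++ (y , false) ∷ rest ∎)

  slide-labelled : ∀ fuel L v → length L ≤ fuel → Increasing L → rectify 1 (letters L) ≡ letters L →
    slide (firstRow L) (secondRow L) v ≡ rows (slideResult L v)
  slide-labelled fuel [] v _ _ _ = refl
  slide-labelled fuel ((y , false) ∷ L) v _ (a ∷ _) e
    rewrite slide-below-first y (firstRow L) (secondRow L) v (firstRow-All L a)
          | rectifyL-stable 0 L (∷-injectiveʳ e)
          | firstRow-++ L [ (v , false) ] | secondRow-++ L [ (v , false) ]
          | ++-identityʳ (firstRow L) = refl
  slide-labelled (suc fuel) ((x , true) ∷ L) v (s≤s le) (a ∷ i) e with firstSecondRow L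
  ... | none allL
    rewrite secondRow-AllFirst L allL | rectifyL-AllFirst 1 L allL | hitsFloor-AllFirst 1 L allL
          | firstRow-++ L [ (v , true) ] | secondRow-++ L [ (v , true) ] | secondRow-AllFirst L allL = refl
  ... | atSecond A y B allA refl =
    slide-past-first x A y B v (All-middle A (y , false) B a) allA
      (slide-labelled fuel (A ++ B) v (≤-trans (<⇒≤ (length-remove A (y , false) B)) le)
        (Increasing-remove A (y , false) B i) B-ballot)
    where
    B-ballot : rectify 1 (letters (A ++ B)) ≡ letters (A ++ B)
    B-ballot = trans (rectify-AllFirst-++ 1 A B allA) (trans (cong (letters A ++_) rest-ballot) (sym (letters-++ A B)))
      where
      rest-ballot : rectify (length A + 1) (letters B) ≡ letters B
      rest-ballot = ∷-injectiveʳ (LP.++-cancelˡ (letters A) _ _ (begin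
          letters A ++ false ∷ rectify (length A + 1) (letters B)
        ≡⟨ cong (λ z → letters A ++ rectify z (false ∷ letters B)) (sym (+-suc (length A) 1)) ⟩
          letters A ++ rectify (length A + 2) (letters ((y , false) ∷ B))
        ≡⟨ sym (rectify-AllFirst-++ 2 A ((y , false) ∷ B) allA) ⟩
          rectify 2 (letters (A ++ (y , false) ∷ B))
        ≡⟨ ∷-injectiveʳ e ⟩
          letters (A ++ (y , false) ∷ B)
        ≡⟨ letters-++ A _ ⟩
          letters A ++ false ∷ letters B ∎))
        where open ≡-Reasoning


module Tableaux where

  open BallotWord
  open Slide

  label : ℕ → List Bool → Labelled
  label o [] = []
  label o (b ∷ w) = (suc o , b) ∷ label (suc o) w

  tableau : List Bool → Tab
  tableau w = mkTab (firstRow (label 0 w)) (secondRow (label 0 w))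

  rectifyL-label : ∀ c o w → rectifyL c (label o w) ≡ label o (rectify c w)
  rectifyL-label c o [] = refl
  rectifyL-label c o (true ∷ w) = cong (_ ∷_) (rectifyL-label (suc c) (suc o) w)
  rectifyL-label zero o (false ∷ w) = cong (_ ∷_) (rectifyL-label zero (suc o) w)
  rectifyL-label (suc c) o (false ∷ w) = cong (_ ∷_) (rectifyL-label c (suc o) w)

  letters-label : ∀ o w → letters (label o w) ≡ w
  letters-label o [] = refl
  letters-label o (b ∷ w) = cong (b ∷_) (letters-label (suc o) w)

  label-above : ∀ o w → All (λ q → o < proj₁ q) (label o w)
  label-above o [] = []
  label-above o (b ∷ w) = ≤-refl ∷ All.map (λ {q} lt → <-trans (n<1+n o) lt) (label-above (suc o) w)

  Increasing-label : ∀ o w → Increasing (label o w)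
  Increasing-label o [] = []
  Increasing-label o (b ∷ w) = label-above (suc o) w ∷ Increasing-label (suc o) w

  length-label : ∀ o w → length (label o w) ≡ length w
  length-label o [] = refl
  length-label o (b ∷ w) = cong suc (length-label (suc o) w)

  firstRow-pred : ∀ o w → map pred (firstRow (label (suc o) w)) ≡ firstRow (label o w)
  firstRow-pred o [] = refl
  firstRow-pred o (true ∷ w) = cong (suc o ∷_) (firstRow-pred (suc o) w)
  firstRow-pred o (false ∷ w) = firstRow-pred (suc o) w

  secondRow-pred : ∀ o w → map pred (secondRow (label (suc o) w)) ≡ secondRow (label o w)
  secondRow-pred o [] = refl
  secondRow-pred o (true ∷ w) = secondRow-pred (suc o) w
  secondRow-pred o (false ∷ w) = cong (suc o ∷_) (secondRow-pred (suc o) w)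

  label-++ : ∀ o u v → label o (u ++ v) ≡ label o u ++ label (o + length u) v
  label-++ o [] v = cong (λ z → label z v) (sym (+-identityʳ o))
  label-++ o (b ∷ u) v =
    cong (_ ∷_) (trans (label-++ (suc o) u v) (cong (λ z → label (suc o) u ++ label z v) (sym (+-suc o (length u)))))

  promote-tableau : ∀ u → rectify 0 u ≡ u → promote (length u) (tableau u) ≡ tableau (promoteWord u)
  promote-tableau [] _ = refl
  promote-tableau (false ∷ t) ()
  promote-tableau (true ∷ t) e = goal
    where
    e1 : rectify 1 t ≡ t
    e1 = ∷-injectiveʳ e
    slides : slide (firstRow (label 0 t)) (secondRow (label 0 t)) (suc (length t)) ≡ rows (slideResult (label 0 t) (suc (length t)))
    slides = slide-labelled (length t) (label 0 t) (suc (length t)) (≤-reflexive (length-label 0 t)) (Increasing-label 0 t)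
           (trans (cong (rectify 1) (letters-label 0 t)) (trans e1 (sym (letters-label 0 t))))
    resEq : slideResult (label 0 t) (suc (length t)) ≡ label 0 (promoteWord (true ∷ t))
    resEq = trans (cong₂ _++_ (rectifyL-label 0 0 t) (cong (λ b → [ (suc (length t) , not b) ]) (cong (hitsFloor 0) (letters-label 0 t))))
              (trans (cong (λ z → label 0 (rectify 0 t) ++ [ (suc z , not (hitsFloor 0 t)) ]) (sym (length-rectify 0 t)))
                (sym (label-++ 0 (rectify 0 t) [ not (hitsFloor 0 t) ])))
    goal : promote (length (true ∷ t)) (tableau (true ∷ t)) ≡ tableau (promoteWord (true ∷ t))
    goal rewrite firstRow-pred 0 t | secondRow-pred 0 t | slides | resEq = refl

  label-below : ∀ o w → All (λ q → proj₁ q ≤ o + length w) (label o w)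
  label-below o [] = []
  label-below o (b ∷ w) = subst (λ m → All (λ q → proj₁ q ≤ m) ((suc o , b) ∷ label (suc o) w)) (sym (+-suc o (length w)))
    (s≤s (m≤m+n o (length w)) ∷ label-below (suc o) w)

  label-take-drop : ∀ k w → k ≤ length w → label 0 w ≡ label 0 (take k w) ++ label k (drop k w)
  label-take-drop k w le = begin
      label 0 w
    ≡⟨ cong (label 0) (sym (take++drop≡id k w)) ⟩
      label 0 (take k w ++ drop k w)
    ≡⟨ label-++ 0 (take k w) (drop k w) ⟩
      label 0 (take k w) ++ label (length (take k w)) (drop k w)
    ≡⟨ cong (λ z → label 0 (take k w) ++ label z (drop k w)) (length-take-≤ k w le) ⟩
      label 0 (take k w) ++ label k (drop k w) ∎
    where open ≡-Reasoning

  IsRowFilter : (Labelled → List ℕ) → Set₁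
  IsRowFilter f = (∀ {P : ℕ → Set} L → All (λ q → P (proj₁ q)) L → All P (f L)) × (∀ L M → f (L ++ M) ≡ f L ++ f M)

  firstRow-filter : IsRowFilter firstRow
  firstRow-filter = firstRow-All , firstRow-++

  secondRow-filter : IsRowFilter secondRow
  secondRow-filter = secondRow-All , secondRow-++

  restrict-label : ∀ {f} → IsRowFilter f → ∀ k w → k ≤ length w → filter (_≤? k) (f (label 0 w)) ≡ f (label 0 (take k w))
  restrict-label {f} (sub , f++) k w le
    rewrite label-take-drop k w le | f++ (label 0 (take k w)) (label k (drop k w))
          | LP.filter-++ (_≤? k) (f (label 0 (take k w))) (f (label k (drop k w)))
          | LP.filter-all (_≤? k) {f (label 0 (take k w))} (sub (label 0 (take k w)) (All.map (subst (_ ≤_) (length-take-≤ k w le)) (label-below 0 (take k w))))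
          | LP.filter-none (_≤? k) {f (label k (drop k w))} (sub (label k (drop k w)) (All.map <⇒≱ (label-above k (drop k w))))
    = ++-identityʳ _

  above-label : ∀ {f} → IsRowFilter f → ∀ k w → k ≤ length w → above k (f (label 0 w)) ≡ f (label k (drop k w))
  above-label {f} (sub , f++) k w le
    rewrite label-take-drop k w le | f++ (label 0 (take k w)) (label k (drop k w))
          | LP.filter-++ (λ x → ¬? (x ≤? k)) (f (label 0 (take k w))) (f (label k (drop k w)))
          | LP.filter-none (λ x → ¬? (x ≤? k)) {f (label 0 (take k w))}
              (sub (label 0 (take k w)) (All.map (λ le' nle → nle (subst (_ ≤_) (length-take-≤ k w le) le')) (label-below 0 (take k w))))
          | LP.filter-all (λ x → ¬? (x ≤? k)) {f (label k (drop k w))} (sub (label k (drop k w)) (All.map <⇒≱ (label-above k (drop k w))))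
    = refl

  restrict-tableau : ∀ k w → k ≤ length w → restrict k (tableau w) ≡ tableau (take k w)
  restrict-tableau k w le = cong₂ mkTab (restrict-label firstRow-filter k w le) (restrict-label secondRow-filter k w le)

  length-promoteWord : ∀ u → length (promoteWord u) ≡ length u
  length-promoteWord [] = refl
  length-promoteWord (b ∷ t) = trans (length-++ (rectify 0 t)) (trans (+-comm (length (rectify 0 t)) 1) (cong suc (length-rectify 0 t)))

  P-tableau : ∀ k w → rectify 0 (take k w) ≡ take k w → k ≤ length w → P k (tableau w) ≡ tableau (promoteWordAt k w)
  P-tableau k w e le = cong₂ mkTab (trans (cong (λ S → row1 S ++ above k (firstRow (label 0 w))) S≡) (part firstRow-filter))
                                (trans (cong (λ S → row2 S ++ above k (secondRow (label 0 w))) S≡) (part secondRow-filter))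
    where
    u = take k w
    d = drop k w
    lu : length u ≡ k
    lu = length-take-≤ k w le
    S≡ : promote k (restrict k (tableau w)) ≡ tableau (promoteWord u)
    S≡ = trans (cong (promote k) (restrict-tableau k w le)) (trans (cong (λ z → promote z (tableau u)) (sym lu)) (promote-tableau u e))
    part : ∀ {f} → IsRowFilter f → f (label 0 (promoteWord u)) ++ above k (f (label 0 w)) ≡ f (label 0 (promoteWordAt k w))
    part {f} (sub , f++) rewrite above-label (sub , f++) k w le | label-++ 0 (promoteWord u) d | length-promoteWord u | lu =
      sym (f++ (label 0 (promoteWord u)) (label k d))


module TableauWords where

  open BallotWord
  open Slide
  open Tableaux

  rectify-prefix-stable : ∀ s r → rectify 0 (take (length s) (rectify 0 s ++ r)) ≡ take (length s) (rectify 0 s ++ r)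
  rectify-prefix-stable s r rewrite sym (length-rectify 0 s) | take-length-++ (rectify 0 s) r = rectify-rectify 0 0 s

  length-rectify-prefix : ∀ s r → length s ≤ length (rectify 0 s ++ r)
  length-rectify-prefix s r rewrite length-++ (rectify 0 s) {r} | length-rectify 0 s = m≤m+n (length s) (length r)

  -- The letters still to be processed form the ballot word rectify 0 s; those in r are final.
  evacFrom-tableau : ∀ s r → evacFrom (length s) (tableau (rectify 0 s ++ r)) ≡ tableau (evacWord s ++ r)
  evacFrom-tableau [] r = refl
  evacFrom-tableau (h ∷ t) r = begin
      evacFrom (length t) (P (suc (length t)) (tableau (rectify 0 (h ∷ t) ++ r)))
    ≡⟨ cong (evacFrom (length t)) (P-tableau (length (h ∷ t)) _ (rectify-prefix-stable (h ∷ t) r) (length-rectify-prefix (h ∷ t) r)) ⟩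
      evacFrom (length t) (tableau (promoteWordAt (suc (length t)) (rectify 0 (h ∷ t) ++ r)))
    ≡⟨ cong (λ z → evacFrom (length t) (tableau z)) (promoteWordAt-evac-step h t r) ⟩
      evacFrom (length t) (tableau (rectify 0 t ++ (promotedLetter (h ∷ t) ∷ r)))
    ≡⟨ evacFrom-tableau t _ ⟩
      tableau (evacWord t ++ (promotedLetter (h ∷ t) ∷ r))
    ≡⟨ cong tableau (sym (++-assoc (evacWord t) _ r)) ⟩
      tableau (evacWord (h ∷ t) ++ r) ∎
    where open ≡-Reasoning

  foldFrom-tableau : ∀ m s r → length s ≡ 2 * m → foldFrom m (tableau (rectify 0 s ++ r)) ≡ tableau (foldWord m s ++ r)
  foldFrom-tableau zero [] r _ = refl
  foldFrom-tableau (suc m) s r len = begin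
      foldFrom m (P (2 * suc m) (tableau (rectify 0 s ++ r)))
    ≡⟨ cong (foldFrom m) (subst (λ k → P k (tableau (rectify 0 s ++ r)) ≡ tableau (promoteWordAt k (rectify 0 s ++ r))) len
          (P-tableau (length s) _ (rectify-prefix-stable s r) (length-rectify-prefix s r))) ⟩
      foldFrom m (tableau (promoteWordAt (2 * suc m) (rectify 0 s ++ r)))
    ≡⟨ cong (λ z → foldFrom m (tableau z)) (promoteWordAt-fold-step m s r len) ⟩
      foldFrom m (tableau (rectify 0 (inner m s) ++ _))
    ≡⟨ foldFrom-tableau m (inner m s) _ (length-inner m s len) ⟩
      tableau (foldWord m (inner m s) ++ _)
    ≡⟨ cong tableau (sym (foldWord-suc-++ m s r)) ⟩
      tableau (foldWord (suc m) s ++ r) ∎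
    where open ≡-Reasoning

  F-tableau : ∀ n w → rectify 0 w ≡ w → length w ≡ 2 * n → F n (tableau w) ≡ tableau (foldWord n w)
  F-tableau n w ballot len = begin
      foldFrom n (tableau w)
    ≡⟨ cong (λ z → foldFrom n (tableau z)) (sym (trans (++-identityʳ (rectify 0 w)) ballot)) ⟩
      foldFrom n (tableau (rectify 0 w ++ []))
    ≡⟨ foldFrom-tableau n w [] len ⟩
      tableau (foldWord n w ++ [])
    ≡⟨ cong tableau (++-identityʳ (foldWord n w)) ⟩
      tableau (foldWord n w) ∎
    where open ≡-Reasoning


module Yamanouchi where

  open BallotWord
  open Slide
  open Tableaux

  asSecond : ℕ → ℕ × Bool
  asSecond y = y , false

  asFirst : ℕ → ℕ × Bool
  asFirst y = y , true

  mergeRows : List ℕ → List ℕ → Labelled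
  mergeRows [] ys = map asSecond ys
  mergeRows (x ∷ xs) [] = map asFirst (x ∷ xs)
  mergeRows (x ∷ xs) (y ∷ ys) = if x <ᵇ y then (x , true) ∷ mergeRows xs (y ∷ ys) else (y , false) ∷ mergeRows (x ∷ xs) ys

  firstRow-asSecond : ∀ ys → firstRow (map asSecond ys) ≡ []
  firstRow-asSecond [] = refl
  firstRow-asSecond (y ∷ ys) = firstRow-asSecond ys

  secondRow-asSecond : ∀ ys → secondRow (map asSecond ys) ≡ ys
  secondRow-asSecond [] = refl
  secondRow-asSecond (y ∷ ys) = cong (y ∷_) (secondRow-asSecond ys)

  firstRow-asFirst : ∀ ys → firstRow (map asFirst ys) ≡ ys
  firstRow-asFirst [] = refl
  firstRow-asFirst (y ∷ ys) = cong (y ∷_) (firstRow-asFirst ys)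

  secondRow-asFirst : ∀ ys → secondRow (map asFirst ys) ≡ []
  secondRow-asFirst [] = refl
  secondRow-asFirst (y ∷ ys) = secondRow-asFirst ys

  entries-asSecond : ∀ ys → map proj₁ (map asSecond ys) ≡ ys
  entries-asSecond ys = trans (sym (LP.map-∘ ys)) (LP.map-id ys)

  entries-asFirst : ∀ ys → map proj₁ (map asFirst ys) ≡ ys
  entries-asFirst ys = trans (sym (LP.map-∘ ys)) (LP.map-id ys)

  firstRow-mergeRows : ∀ xs ys → firstRow (mergeRows xs ys) ≡ xs
  firstRow-mergeRows [] ys = firstRow-asSecond ys
  firstRow-mergeRows (x ∷ xs) ys = go ys
    where
    go : ∀ ys → firstRow (mergeRows (x ∷ xs) ys) ≡ x ∷ xs
    go [] = cong (x ∷_) (firstRow-asFirst xs)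
    go (y ∷ ys) with x <ᵇ y
    ... | true = cong (x ∷_) (firstRow-mergeRows xs (y ∷ ys))
    ... | false = go ys

  secondRow-mergeRows : ∀ xs ys → secondRow (mergeRows xs ys) ≡ ys
  secondRow-mergeRows [] ys = secondRow-asSecond ys
  secondRow-mergeRows (x ∷ xs) ys = go ys
    where
    go : ∀ ys → secondRow (mergeRows (x ∷ xs) ys) ≡ ys
    go [] = secondRow-asFirst xs
    go (y ∷ ys) with x <ᵇ y
    ... | true = secondRow-mergeRows xs (y ∷ ys)
    ... | false = cong (y ∷_) (go ys)

  entries-mergeRows-↭ : ∀ xs ys → map proj₁ (mergeRows xs ys) ↭ xs ++ ys
  entries-mergeRows-↭ [] ys = subst (_↭ ys) (sym (entries-asSecond ys)) ↭-refl
  entries-mergeRows-↭ (x ∷ xs) ys = go ys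
    where
    go : ∀ ys → map proj₁ (mergeRows (x ∷ xs) ys) ↭ (x ∷ xs) ++ ys
    go [] = subst (_↭ (x ∷ xs ++ [])) (cong (x ∷_) (trans (++-identityʳ xs) (sym (entries-asFirst xs)))) ↭-refl
    go (y ∷ ys) with x <ᵇ y
    ... | true = prep x (entries-mergeRows-↭ xs (y ∷ ys))
    ... | false = ↭-trans (prep y (go ys)) (↭-sym (shift y (x ∷ xs) ys))

  Bounds : ℕ → List ℕ → Set
  Bounds a [] = ⊤
  Bounds a (x ∷ _) = a ≤ x

  Linked-cons : ∀ {a l} → Bounds a l → Linked _≤_ l → Linked _≤_ (a ∷ l)
  Linked-cons {l = []} _ _ = [-]
  Linked-cons {l = x ∷ l} le at = le ∷ at

  Bounds-head : ∀ {a l} → Linked _<_ (a ∷ l) → Bounds a l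
  Bounds-head [-] = tt
  Bounds-head (lt ∷ _) = <⇒≤ lt

  Bounds-mergeRows : ∀ a xs ys → Bounds a xs → Bounds a ys → Bounds a (map proj₁ (mergeRows xs ys))
  Bounds-mergeRows a [] ys _ lb = subst (Bounds a) (sym (entries-asSecond ys)) lb
  Bounds-mergeRows a (x ∷ xs) [] lb _ = lb
  Bounds-mergeRows a (x ∷ xs) (y ∷ ys) lx ly with x <ᵇ y
  ... | true = lx
  ... | false = ly

  mergeRows-sorted : ∀ xs ys → Linked _<_ xs → Linked _<_ ys → Linked _≤_ (map proj₁ (mergeRows xs ys))
  mergeRows-sorted [] ys _ l = subst (Linked _≤_) (sym (entries-asSecond ys)) (Linked.map <⇒≤ l)
  mergeRows-sorted (x ∷ xs) ys lx = go ys
    where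
    go : ∀ ys → Linked _<_ ys → Linked _≤_ (map proj₁ (mergeRows (x ∷ xs) ys))
    go [] _ = subst (Linked _≤_) (sym (cong (x ∷_) (entries-asFirst xs))) (Linked.map <⇒≤ lx)
    go (y ∷ ys) ly with x <ᵇ y in eq
    ... | true = Linked-cons (Bounds-mergeRows x xs (y ∷ ys) (Bounds-head lx) (<⇒≤ (<ᵇ⇒< x y (subst T (sym eq) tt))))
                   (mergeRows-sorted xs (y ∷ ys) (Linked.tail lx) ly)
    ... | false = Linked-cons (Bounds-mergeRows y (x ∷ xs) ys (≮⇒≥ (λ lt → subst T eq (<⇒<ᵇ lt))) (Bounds-head ly))
                   (go ys (Linked.tail ly))

  interval : ℕ → ℕ → List ℕ
  interval o zero = []
  interval o (suc m) = suc o ∷ interval (suc o) m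

  applyUpTo-interval : ∀ (f : ℕ → ℕ) o n → (∀ i → f i ≡ suc (o + i)) → applyUpTo f n ≡ interval o n
  applyUpTo-interval f o zero _ = refl
  applyUpTo-interval f o (suc n) h =
    cong₂ _∷_ (trans (h 0) (cong suc (+-identityʳ o)))
      (applyUpTo-interval (λ i → f (suc i)) (suc o) n (λ i → trans (h (suc i)) (cong suc (+-suc o i))))

  length-interval : ∀ o m → length (interval o m) ≡ m
  length-interval o zero = refl
  length-interval o (suc m) = cong suc (length-interval (suc o) m)

  map-suc-upTo : ∀ N → map suc (upTo N) ≡ interval 0 N
  map-suc-upTo N = trans (LP.map-applyUpTo (λ i → i) suc N) (applyUpTo-interval suc 0 N (λ i → refl))

  interval-sorted : ∀ o n → Linked _≤_ (interval o n)
  interval-sorted o zero = []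
  interval-sorted o (suc zero) = [-]
  interval-sorted o (suc (suc n)) = n≤1+n (suc o) ∷ interval-sorted (suc o) (suc n)

  label-entries : ∀ o L → map proj₁ L ≡ interval o (length L) → L ≡ label o (letters L)
  label-entries o [] _ = refl
  label-entries o ((p , b) ∷ L) e with LP.∷-injective e
  ... | refl , e' = cong ((suc o , b) ∷_) (label-entries (suc o) L e')

  rectify-asSecond : ∀ c ys → length ys ≤ c → rectify c (letters (map asSecond ys)) ≡ letters (map asSecond ys)
  rectify-asSecond c [] _ = refl
  rectify-asSecond (suc c) (y ∷ ys) (s≤s le) = cong (false ∷_) (rectify-asSecond c ys le)

  height-asSecond : ∀ c ys → length ys ≡ c → height c (letters (map asSecond ys)) ≡ 0
  height-asSecond c [] refl = refl
  height-asSecond (suc c) (y ∷ ys) e = height-asSecond c ys (suc-injective e)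

  -- The column condition says that the i-th entry of row 2 comes after i entries of row 1;
  -- here c counts the row-1 entries already read.
  mergeRows-ballot : ∀ c xs ys → Pointwise _<_ xs (drop c ys) → length ys ≡ length xs + c →
     rectify c (letters (mergeRows xs ys)) ≡ letters (mergeRows xs ys) × height c (letters (mergeRows xs ys)) ≡ 0
  mergeRows-ballot c [] ys pw len = rectify-asSecond c ys (≤-reflexive len) , height-asSecond c ys len
  mergeRows-ballot c (x ∷ xs) ys pw len = go c ys pw len
    where
    go : ∀ c ys → Pointwise _<_ (x ∷ xs) (drop c ys) → length ys ≡ suc (length xs) + c →
         rectify c (letters (mergeRows (x ∷ xs) ys)) ≡ letters (mergeRows (x ∷ xs) ys) × height c (letters (mergeRows (x ∷ xs) ys)) ≡ 0
    go c [] pw len = ⊥-elim (1+n≢0 (sym len))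
    go c (y ∷ ys) pw len with x <ᵇ y in eq
    go c (y ∷ ys) pw len | true with drop c (y ∷ ys) in eqd | pw
    ... | z ∷ zs | _ ∷ pw' with mergeRows-ballot (suc c) xs (y ∷ ys) (subst (Pointwise _<_ xs) (sym (drop-suc-∷ c (y ∷ ys) z zs eqd)) pw') (trans len (sym (+-suc (length xs) c)))
    ... | r , k = cong (true ∷_) r , k
    go zero (y ∷ ys) (lt ∷ pw) len | false = ⊥-elim (subst T eq (<⇒<ᵇ lt))
    go (suc c) (y ∷ ys) pw len | false with go c ys pw (suc-injective (trans len (+-suc (suc (length xs)) c)))
    ... | r , k = cong (false ∷_) r , k

  record YamanouchiWord (n : ℕ) (T : Tab) : Set where
    field
      w : List Bool
      T≡tableau : T ≡ tableau w
      length-w : length w ≡ 2 * n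
      ballot : rectify 0 w ≡ w
      balanced : height 0 w ≡ 0

  yamanouchiWord : ∀ n T → IsSYT n T → YamanouchiWord n T
  yamanouchiWord n (mkTab r1 r2) syt = record
    { w = letters L ; T≡tableau = T≡ ; length-w = lenw ; ballot = proj₁ bm ; balanced = proj₂ bm }
    where
    open IsSYT syt
    L = mergeRows r1 r2
    pL : map proj₁ L ≡ interval 0 (2 * n)
    pL =
      trans (Pointwise.Pointwise-≡⇒≡ (↗↭↗⇒≋ ≤-totalOrder (mergeRows-sorted r1 r2 rowInc1 rowInc2) (subst (Linked _≤_) (sym (map-suc-upTo (2 * n))) (interval-sorted 0 (2 * n)))
              (↭⇒↭ₛ (↭-trans (entries-mergeRows-↭ r1 r2) entries)))) (map-suc-upTo (2 * n))
    lenL : length L ≡ 2 * n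
    lenL = trans (sym (LP.length-map proj₁ L)) (trans (cong length pL) (length-interval 0 (2 * n)))
    Leq : L ≡ label 0 (letters L)
    Leq = label-entries 0 L (trans pL (cong (interval 0) (sym lenL)))
    T≡ : mkTab r1 r2 ≡ tableau (letters L)
    T≡ = trans (cong₂ mkTab (sym (firstRow-mergeRows r1 r2)) (sym (secondRow-mergeRows r1 r2))) (cong (λ M → mkTab (firstRow M) (secondRow M)) Leq)
    lenw : length (letters L) ≡ 2 * n
    lenw = trans (LP.length-map proj₂ L) lenL
    bm = mergeRows-ballot 0 r1 r2 cols (trans (sym (Pointwise.Pointwise-length cols)) (sym (+-identityʳ (length r1))))


module DyckWords where

  open BallotWord

  data Dyck : List Bool → Set where
    ε : Dyck []
    nest : ∀ {a b} → Dyck a → Dyck b → Dyck (true ∷ a ++ false ∷ b)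

  Dyck-rectify : ∀ {D} → Dyck D → ∀ c → rectify c D ≡ D × height c D ≡ c
  Dyck-rectify ε c = refl , refl
  Dyck-rectify (nest {a} {b} da db) c with Dyck-rectify da (suc c) | Dyck-rectify db c
  ... | ra , ha | rb , hb =
    cong (true ∷_) (trans (rectify-++ (suc c) a (false ∷ b))
                     (cong₂ _++_ ra (trans (cong (λ z → rectify z (false ∷ b)) ha) (cong (false ∷_) rb))))
    , trans (height-++ (suc c) a (false ∷ b)) (trans (cong (λ z → height z (false ∷ b)) ha) hb)

  Dyck-hitsFloor : ∀ {D} → Dyck D → ∀ c r → hitsFloor c (D ++ r) ≡ hitsFloor c r
  Dyck-hitsFloor ε c r = refl
  Dyck-hitsFloor (nest {a} {b} da db) c r =
    trans (cong (hitsFloor (suc c)) (++-assoc a (false ∷ b) r)) (trans (Dyck-hitsFloor da (suc c) (false ∷ b ++ r)) (Dyck-hitsFloor db c r))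

  Dyck-++ : ∀ {x y} → Dyck x → Dyck y → Dyck (x ++ y)
  Dyck-++ ε dy = dy
  Dyck-++ {y = y} (nest {a} {b} da db) dy = subst Dyck (cong (true ∷_) (sym (++-assoc a (false ∷ b) y))) (nest da (Dyck-++ db dy))

  revCompl : List Bool → List Bool
  revCompl D = reverse (map not D)

  revCompl-++ : ∀ x y → revCompl (x ++ y) ≡ revCompl y ++ revCompl x
  revCompl-++ x y = trans (cong reverse (LP.map-++ not x y)) (LP.reverse-++ (map not x) (map not y))

  revCompl-∷ : ∀ b x → revCompl (b ∷ x) ≡ revCompl x ++ [ not b ]
  revCompl-∷ b x = LP.unfold-reverse (not b) (map not x)

  length-revCompl : ∀ w → length (revCompl w) ≡ length w
  length-revCompl w = trans (LP.length-reverse (map not w)) (LP.length-map not w)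

  Dyck-revCompl : ∀ {D} → Dyck D → Dyck (revCompl D)
  Dyck-revCompl ε = ε
  Dyck-revCompl (nest {a} {b} da db) = subst Dyck (sym eq) (Dyck-++ (Dyck-revCompl db) (nest (Dyck-revCompl da) ε))
    where
    eq : revCompl (true ∷ a ++ false ∷ b) ≡ revCompl b ++ (true ∷ revCompl a ++ false ∷ [])
    eq = begin
        revCompl (true ∷ a ++ false ∷ b)
      ≡⟨ revCompl-∷ true (a ++ false ∷ b) ⟩
        revCompl (a ++ false ∷ b) ++ [ false ]
      ≡⟨ cong (_++ [ false ]) (revCompl-++ a (false ∷ b)) ⟩
        (revCompl (false ∷ b) ++ revCompl a) ++ [ false ]
      ≡⟨ cong (λ z → (z ++ revCompl a) ++ [ false ]) (revCompl-∷ false b) ⟩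
        ((revCompl b ++ [ true ]) ++ revCompl a) ++ [ false ]
      ≡⟨ trans (++-assoc (revCompl b ++ [ true ]) (revCompl a) _) (++-assoc (revCompl b) [ true ] _) ⟩
        revCompl b ++ (true ∷ revCompl a ++ false ∷ []) ∎
      where open ≡-Reasoning

  Dyck⇒¬Dyck-++-false∷ : ∀ {D r} → Dyck D → Dyck (D ++ false ∷ r) → ⊥
  Dyck⇒¬Dyck-++-false∷ {D} {r} dD dA = true≢false (∷-injectiveˡ (LP.++-cancelˡ D _ _ eq))
    where
    eq : D ++ true ∷ rectify 0 r ≡ D ++ false ∷ r
    eq = begin
        D ++ true ∷ rectify 0 r
      ≡⟨ cong (_++ true ∷ rectify 0 r) (sym (proj₁ (Dyck-rectify dD 0))) ⟩
        rectify 0 D ++ rectify 0 (false ∷ r)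
      ≡⟨ cong (λ z → rectify 0 D ++ rectify z (false ∷ r)) (sym (proj₂ (Dyck-rectify dD 0))) ⟩
        rectify 0 D ++ rectify (height 0 D) (false ∷ r)
      ≡⟨ sym (rectify-++ 0 D (false ∷ r)) ⟩
        rectify 0 (D ++ false ∷ r)
      ≡⟨ proj₁ (Dyck-rectify dA 0) ⟩
        D ++ false ∷ r ∎
      where open ≡-Reasoning

  at : List Bool → ℕ → Bool
  at [] i = false
  at (b ∷ w) zero = b
  at (b ∷ w) (suc i) = at w i

  slice : List Bool → ℕ → ℕ → List Bool
  slice w i k = take k (drop i w)

  at-drop : ∀ w i x → at (drop i w) x ≡ at w (i + x)
  at-drop w zero x = refl
  at-drop [] (suc i) x = refl
  at-drop (b ∷ w) (suc i) x = at-drop w i x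

  take-split-at : ∀ (u : List Bool) x y → x < length u → take (x + suc y) u ≡ take x u ++ at u x ∷ take y (drop (suc x) u)
  take-split-at (b ∷ u) zero y _ = refl
  take-split-at (b ∷ u) (suc x) y (s≤s lt) = cong (b ∷_) (take-split-at u x y lt)

  slice-split : ∀ w i x y → i + x < length w → slice w i (x + suc y) ≡ slice w i x ++ at w (i + x) ∷ slice w (suc (i + x)) y
  slice-split w i x y lt = trans (take-split-at (drop i w) x y lt')
     (cong₂ (λ a b → slice w i x ++ a ∷ b) (at-drop w i x) (cong (take y) (trans (LP.drop-drop i (suc x) w) (cong (λ z → drop z w) (+-suc i x)))))
    where
    lt' : x < length (drop i w)
    lt' rewrite LP.length-drop i w = +-cancelˡ-< i x (length w ∸ i) (subst (i + x <_) (sym (m+[n∸m]≡n (≤-trans (m≤m+n i x) (<⇒≤ lt)))) lt)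

  at-++ˡ : ∀ u v i → i < length u → at (u ++ v) i ≡ at u i
  at-++ˡ (b ∷ u) v zero _ = refl
  at-++ˡ (b ∷ u) v (suc i) (s≤s lt) = at-++ˡ u v i lt

  at-++ʳ : ∀ u v i → at (u ++ v) (length u + i) ≡ at v i
  at-++ʳ [] v i = refl
  at-++ʳ (b ∷ u) v i = at-++ʳ u v i

  slice-++ : ∀ u v k → slice (u ++ v) (length u) k ≡ take k v
  slice-++ u v k = cong (take k) (drop-length-++ u v)

  rectifyLetter : ℕ → Bool → Bool
  rectifyLetter c true = true
  rectifyLetter zero false = true
  rectifyLetter (suc c) false = false

  rectifyLetter-at : ∀ c l → at (rectify c [ l ]) 0 ≡ rectifyLetter c l
  rectifyLetter-at c true = refl
  rectifyLetter-at zero false = refl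
  rectifyLetter-at (suc c) false = refl


module Evacuation where

  open BallotWord
  open Slide
  open Tableaux
  open TableauWords
  open Yamanouchi
  open DyckWords

  hitsFloor-mono : ∀ c d t → c ≤ d → hitsFloor d t ≡ true → hitsFloor c t ≡ true
  hitsFloor-mono c d (true ∷ t) le h = hitsFloor-mono (suc c) (suc d) t (s≤s le) h
  hitsFloor-mono zero d (false ∷ t) le h = refl
  hitsFloor-mono (suc c) (suc d) (false ∷ t) (s≤s le) h = hitsFloor-mono c d t le h

  height-positive : ∀ c t → hitsFloor c t ≡ false → rectify (suc c) t ≡ t → 1 ≤ height (suc c) t
  height-positive c [] _ _ = s≤s z≤n
  height-positive c (true ∷ t) h e = height-positive (suc c) t h (∷-injectiveʳ e)
  height-positive zero (false ∷ t) () e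
  height-positive (suc c) (false ∷ t) h e = height-positive c t h (∷-injectiveʳ e)

  rectify-prefix : ∀ u v → rectify 0 (u ++ v) ≡ u ++ v → rectify 0 u ≡ u
  rectify-prefix u v e = ++-prefix-≡ (rectify 0 u) _ u v (trans (sym (rectify-++ 0 u v)) e) (length-rectify 0 u)

  promotedLetter-balanced : ∀ u h t → rectify 0 (u ++ h ∷ t) ≡ u ++ h ∷ t → height 0 (u ++ h ∷ t) ≡ 0 → promotedLetter (h ∷ t) ≡ not h
  promotedLetter-balanced u false t e c = refl
  promotedLetter-balanced u true t e c = cong not hitT
    where
    k = height 0 u
    eT : rectify (suc k) t ≡ t
    eT =
      ∷-injectiveʳ (LP.++-cancelˡ (rectify 0 u) _ _ (trans (sym (rectify-++ 0 u (true ∷ t))) (trans e (cong (_++ true ∷ t) (sym (rectify-prefix u (true ∷ t) e))))))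
    hitT : hitsFloor 0 t ≡ true
    hitT with hitsFloor k t in hk
    ... | true = hitsFloor-mono 0 k t z≤n hk
    ... | false = ⊥-elim (n≮0 (subst (1 ≤_) (trans (sym (height-++ 0 u (true ∷ t))) c) (height-positive k t hk eT)))

  evacWord-balanced : ∀ u s → rectify 0 (u ++ s) ≡ u ++ s → height 0 (u ++ s) ≡ 0 → evacWord s ≡ revCompl s
  evacWord-balanced u [] _ _ = refl
  evacWord-balanced u (h ∷ t) e c =
    trans (cong₂ _++_ (evacWord-balanced (u ++ [ h ]) t e' c') (cong [_] (promotedLetter-balanced u h t e c))) (sym (revCompl-∷ h t))
    where
    e' : rectify 0 ((u ++ [ h ]) ++ t) ≡ (u ++ [ h ]) ++ t
    e' = subst (λ z → rectify 0 z ≡ z) (sym (++-assoc u [ h ] t)) e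
    c' : height 0 ((u ++ [ h ]) ++ t) ≡ 0
    c' = subst (λ z → height 0 z ≡ 0) (sym (++-assoc u [ h ] t)) c

  All<-∷-⊥ : ∀ {o xs ys} → All (o <_) xs → xs ≡ o ∷ ys → ⊥
  All<-∷-⊥ (p ∷ _) refl = <-irrefl refl p

  firstRow-label-injective : ∀ o u v → length u ≡ length v → firstRow (label o u) ≡ firstRow (label o v) → u ≡ v
  firstRow-label-injective o [] [] _ _ = refl
  firstRow-label-injective o (true ∷ u) (true ∷ v) l e =
    cong (true ∷_) (firstRow-label-injective (suc o) u v (suc-injective l) (∷-injectiveʳ e))
  firstRow-label-injective o (false ∷ u) (false ∷ v) l e =
    cong (false ∷_) (firstRow-label-injective (suc o) u v (suc-injective l) e)
  firstRow-label-injective o (true ∷ u) (false ∷ v) l e =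
    ⊥-elim (All<-∷-⊥ (firstRow-All (label (suc o) v) (label-above (suc o) v)) (sym e))
  firstRow-label-injective o (false ∷ u) (true ∷ v) l e =
    ⊥-elim (All<-∷-⊥ (firstRow-All (label (suc o) u) (label-above (suc o) u)) e)

  selfComplementary : ∀ n T (Y : YamanouchiWord n T) → RotSym n T → YamanouchiWord.w Y ≡ revCompl (YamanouchiWord.w Y)
  selfComplementary n T Y rotSym = sym (firstRow-label-injective 0 (revCompl w) w (length-revCompl w) (cong row1 eq))
    where
    open YamanouchiWord Y
    eq : tableau (revCompl w) ≡ tableau w
    eq = begin
        tableau (revCompl w)
      ≡⟨ cong tableau (sym (trans (++-identityʳ (evacWord w)) (evacWord-balanced [] w ballot balanced))) ⟩
        tableau (evacWord w ++ [])
      ≡⟨ sym (evacFrom-tableau w []) ⟩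
        evacFrom (length w) (tableau (rectify 0 w ++ []))
      ≡⟨ cong₂ evacFrom length-w (cong tableau (trans (++-identityʳ (rectify 0 w)) ballot)) ⟩
        evacFrom (2 * n) (tableau w)
      ≡⟨ cong (evacFrom (2 * n)) (sym T≡tableau) ⟩
        E (2 * n) T
      ≡⟨ rotSym ⟩
        T
      ≡⟨ T≡tableau ⟩
        tableau w ∎
      where open ≡-Reasoning


module Positions where

  open BallotWord
  open Slide
  open Tableaux
  open DyckWords

  firstRow-label-∈ : ∀ o w v → v ∈ firstRow (label o w) → ∃[ i ] (v ≡ suc (o + i) × i < length w × at w i ≡ true)
  firstRow-label-∈ o [] v ()
  firstRow-label-∈ o (true ∷ w) v (here refl) = 0 , cong suc (sym (+-identityʳ o)) , s≤s z≤n , refl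
  firstRow-label-∈ o (true ∷ w) v (there m) with firstRow-label-∈ (suc o) w v m
  ... | i , e , lt , l = suc i , trans e (cong suc (sym (+-suc o i))) , s≤s lt , l
  firstRow-label-∈ o (false ∷ w) v m with firstRow-label-∈ (suc o) w v m
  ... | i , e , lt , l = suc i , trans e (cong suc (sym (+-suc o i))) , s≤s lt , l

  secondRow-label-∈ : ∀ o w v → v ∈ secondRow (label o w) → ∃[ i ] (v ≡ suc (o + i) × i < length w × at w i ≡ false)
  secondRow-label-∈ o [] v ()
  secondRow-label-∈ o (false ∷ w) v (here refl) = 0 , cong suc (sym (+-identityʳ o)) , s≤s z≤n , refl
  secondRow-label-∈ o (false ∷ w) v (there m) with secondRow-label-∈ (suc o) w v m
  ... | i , e , lt , l = suc i , trans e (cong suc (sym (+-suc o i))) , s≤s lt , l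
  secondRow-label-∈ o (true ∷ w) v m with secondRow-label-∈ (suc o) w v m
  ... | i , e , lt , l = suc i , trans e (cong suc (sym (+-suc o i))) , s≤s lt , l

  ∈-firstRow-label : ∀ o w i → i < length w → at w i ≡ true → suc (o + i) ∈ firstRow (label o w)
  ∈-firstRow-label o (true ∷ w) zero _ _ = here (cong suc (+-identityʳ o))
  ∈-firstRow-label o (true ∷ w) (suc i) (s≤s lt) l =
    there (subst (_∈ firstRow (label (suc o) w)) (cong suc (sym (+-suc o i))) (∈-firstRow-label (suc o) w i lt l))
  ∈-firstRow-label o (false ∷ w) (suc i) (s≤s lt) l =
    subst (_∈ firstRow (label (suc o) w)) (cong suc (sym (+-suc o i))) (∈-firstRow-label (suc o) w i lt l)

  ∈-secondRow-label : ∀ o w i → i < length w → at w i ≡ false → suc (o + i) ∈ secondRow (label o w)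
  ∈-secondRow-label o (false ∷ w) zero _ _ = here (cong suc (+-identityʳ o))
  ∈-secondRow-label o (false ∷ w) (suc i) (s≤s lt) l =
    there (subst (_∈ secondRow (label (suc o) w)) (cong suc (sym (+-suc o i))) (∈-secondRow-label (suc o) w i lt l))
  ∈-secondRow-label o (true ∷ w) (suc i) (s≤s lt) l =
    subst (_∈ secondRow (label (suc o) w)) (cong suc (sym (+-suc o i))) (∈-secondRow-label (suc o) w i lt l)

  at-++-length : ∀ u v → at (u ++ v) (length u) ≡ at v 0
  at-++-length [] v = refl
  at-++-length (b ∷ u) v = at-++-length u v

  at-revCompl : ∀ w i → i < length w → at (revCompl w) i ≡ not (at w (length w ∸ suc i))
  at-revCompl (b ∷ w) i lt with <-cmp i (length w)
  ... | tri< i<w _ _ = begin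
      at (revCompl (b ∷ w)) i
    ≡⟨ cong (λ z → at z i) (revCompl-∷ b w) ⟩
      at (revCompl w ++ [ not b ]) i
    ≡⟨ at-++ˡ (revCompl w) _ i (subst (i <_) (sym (length-revCompl w)) i<w) ⟩
      at (revCompl w) i
    ≡⟨ at-revCompl w i i<w ⟩
      not (at (b ∷ w) (suc (length w ∸ suc i)))
    ≡⟨ cong (λ z → not (at (b ∷ w) z)) (sym (+-∸-assoc 1 i<w)) ⟩
      not (at (b ∷ w) (length w ∸ i)) ∎
    where open ≡-Reasoning
  ... | tri≈ _ refl _ = begin
      at (revCompl (b ∷ w)) (length w)
    ≡⟨ cong (λ z → at z (length w)) (revCompl-∷ b w) ⟩
      at (revCompl w ++ [ not b ]) (length w)
    ≡⟨ cong (at (revCompl w ++ [ not b ])) (sym (length-revCompl w)) ⟩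
      at (revCompl w ++ [ not b ]) (length (revCompl w))
    ≡⟨ at-++-length (revCompl w) [ not b ] ⟩
      not b
    ≡⟨ cong (λ z → not (at (b ∷ w) z)) (sym (n∸n≡0 (length w))) ⟩
      not (at (b ∷ w) (length w ∸ length w)) ∎
    where open ≡-Reasoning
  ... | tri> _ _ i>w = ⊥-elim (<-irrefl refl (≤-trans lt i>w))

  +-≡-<-swap : ∀ {x a y b} → x + a ≡ y + b → a < b → y < x
  +-≡-<-swap {x} {a} {y} {b} e lt with <-cmp y x
  ... | tri< y<x _ _ = y<x
  ... | tri≈ _ refl _ = ⊥-elim (<-irrefl (+-cancelˡ-≡ y a b e) lt)
  ... | tri> _ _ x<y = ⊥-elim (<-irrefl e (+-mono-≤-< (<⇒≤ x<y) lt))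


module WebOfWord (n : ℕ) (w : List Bool) (lenw : length w ≡ 2 * n) (symw : w ≡ DyckWords.revCompl w)
                 (W : Web) (isW : IsWebOf n (Tableaux.tableau w) W) where

  open BallotWord
  open DyckWords
  open Positions

  open IsWebOf isW
  open Is2Web isWeb

  N : ℕ
  N = 2 * n

  left-letter : ∀ {a b} → W a b → at w (pred a) ≡ true
  left-letter {a} {b} ab with firstRow-label-∈ 0 w a (Equivalence.from (left a) (b , ab))
  ... | i , refl , _ , l = l

  right-letter : ∀ {a b} → W a b → at w (pred b) ≡ false
  right-letter {a} {b} ab with secondRow-label-∈ 0 w b (Equivalence.from (right b) (a , ab))
  ... | i , refl , _ , l = l

  left-arc : ∀ i → i < N → at w i ≡ true → ∃[ b ] W (suc i) b
  left-arc i lt l = Equivalence.to (left (suc i)) (∈-firstRow-label 0 w i (subst (i <_) (sym lenw) lt) l)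

  right-arc : ∀ i → i < N → at w i ≡ false → ∃[ a ] W a (suc i)
  right-arc i lt l = Equivalence.to (right (suc i)) (∈-secondRow-label 0 w i (subst (i <_) (sym lenw) lt) l)

  Partner-sym : ∀ {v p} → Partner W v p → Partner W p v
  Partner-sym (inj₁ x) = inj₂ x
  Partner-sym (inj₂ x) = inj₁ x

  bounds : ∀ {a b} → W a b → 1 ≤ a × a < b × b ≤ N
  bounds {a} {b} = arcBounds a b

  Closed : ℕ → ℕ → Set
  Closed l r = ∀ v p → l < v → v < r → Partner W v p → l < p × p < r

  arc-closed : ∀ {a b} → W a b → Closed a b
  arc-closed {a} {b} ab v p av vb (inj₁ vp) with <-cmp p b
  ... | tri< p<b _ _ = <-trans av (proj₁ (proj₂ (bounds vp))) , p<b
  ... | tri≈ _ refl _ = ⊥-elim (<-irrefl (sym (unique b v a (inj₂ vp) (inj₂ ab))) av)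
  ... | tri> _ _ b<p = ⊥-elim (nonCross a b v p ab vp av vb b<p)
  arc-closed {a} {b} ab v p av vb (inj₂ pv) with <-cmp p a
  ... | tri> _ _ a<p = a<p , <-trans (proj₁ (proj₂ (bounds pv))) vb
  ... | tri≈ _ refl _ = ⊥-elim (<-irrefl (unique a v b (inj₁ pv) (inj₁ ab)) vb)
  ... | tri< p<a _ _ = ⊥-elim (nonCross p v a b pv ab p<a av vb)

  closed-split : ∀ {l p r} → Closed l r → W (suc l) p → p < r → Closed p r
  closed-split {l} {p} {r} cl lp pr v q pv vr vq with cl v q (<-trans (<-trans (n<1+n l) (proj₁ (proj₂ (bounds lp)))) pv) vr vq
  ... | lq , qr with <-cmp q p
  ... | tri> _ _ p<q = p<q , qr
  ... | tri≈ _ refl _ = ⊥-elim (<-irrefl (sym (unique q v (suc l) (Partner-sym vq) (inj₂ lp))) (<-trans (proj₁ (proj₂ (bounds lp))) pv))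
  ... | tri< q<p _ _ with <-cmp q (suc l)
  ... | tri< q<sl _ _ = ⊥-elim (<-irrefl refl (≤-trans q<sl lq))
  ... | tri≈ _ refl _ = ⊥-elim (<-irrefl (sym (unique (suc l) v p (Partner-sym vq) (inj₁ lp))) pv)
  ... | tri> _ _ sl<q = ⊥-elim (<-asym pv (proj₂ (arc-closed lp q v sl<q q<p (Partner-sym vq))))

  closed-first-arc : ∀ {l r} → Closed l r → suc l < r → r ≤ suc N → ∃[ p ] (W (suc l) p × p < r)
  closed-first-arc {l} {r} cl slr r≤ with covers (suc l) (s≤s z≤n) (≤-pred (≤-trans slr r≤))
  ... | p , inj₁ lp = p , lp , proj₂ (cl (suc l) p (n<1+n l) slr (inj₁ lp))
  ... | p , inj₂ pl =
    ⊥-elim (<-irrefl refl (≤-trans (proj₁ (proj₂ (bounds pl))) (proj₁ (cl (suc l) p (n<1+n l) slr (inj₂ pl)))))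

  -- Vertex v carries the letter  at w (pred v),  so  slice w l k  holds the letters of the
  -- vertices l+1, …, l+k.  Splitting at the arc {l+1, p} gives  true ∷ D₁ ++ false ∷ D₂.
  closed-Dyck : ∀ fuel l k → k ≤ fuel → l + suc k ≤ suc N → Closed l (l + suc k) → Dyck (slice w l k)
  closed-Dyck fuel l zero _ _ _ = ε
  closed-Dyck (suc fuel) l (suc k) (s≤s kf) rN cl = goal
    where
    r = l + suc (suc k)
    slr : suc l < r
    slr = subst (_≤ l + suc (suc k)) (+-comm l 2) (+-monoʳ-≤ l (s≤s (s≤s z≤n)))
    first = closed-first-arc cl slr rN
    p = proj₁ first
    lp' : W (suc l) p
    lp' = proj₁ (proj₂ first)
    pr : p < r
    pr = proj₂ (proj₂ first)
    slp : suc l < p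
    slp = proj₁ (proj₂ (bounds lp'))
    x = proj₁ (m≤n⇒∃[o]m+o≡n slp)
    ex : suc (suc l) + x ≡ p
    ex = proj₂ (m≤n⇒∃[o]m+o≡n slp)
    y = proj₁ (m≤n⇒∃[o]m+o≡n pr)
    ey : suc p + y ≡ r
    ey = proj₂ (m≤n⇒∃[o]m+o≡n pr)
    e1 : suc (suc (suc (l + x + y))) ≡ suc (suc (l + k))
    e1 = trans (trans (cong (λ z → suc z + y) ex) ey) (trans (+-suc l (suc k)) (cong suc (+-suc l k)))
    kxy : k ≡ x + suc y
    kxy =
      trans (sym (+-cancelˡ-≡ l _ _ (trans (+-suc l (x + y)) (trans (cong suc (sym (+-assoc l x y))) (suc-injective (suc-injective e1)))))) (sym (+-suc x y))
    pN : p ≤ N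
    pN = proj₂ (proj₂ (bounds lp'))
    p≡ : p ≡ suc l + suc x
    p≡ = trans (sym ex) (cong suc (sym (+-suc l x)))
    re : p + suc y ≡ r
    re = trans (+-suc p y) ey
    split1 : slice w l (suc k) ≡ at w l ∷ slice w (suc l) k
    split1 = trans (slice-split w l 0 k (subst (_< length w) (sym (+-identityʳ l)) (subst (l <_) (sym lenw) (≤-pred (≤-trans slr rN)))))
                (cong (λ z → at w z ∷ slice w (suc z) k) (+-identityʳ l))
    split2 : slice w (suc l) k ≡ slice w (suc l) x ++ at w (suc l + x) ∷ slice w p y
    split2 = trans (cong (slice w (suc l)) kxy) (trans (slice-split w (suc l) x y (subst (suc l + x <_) (sym lenw) (≤-trans (≤-reflexive ex) pN)))
                (cong (λ z → slice w (suc l) x ++ at w (suc l + x) ∷ slice w z y) ex))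
    lt1 : at w l ≡ true
    lt1 = left-letter lp'
    lt2 : at w (suc l + x) ≡ false
    lt2 = subst (λ z → at w (pred z) ≡ false) (sym ex) (right-letter lp')
    xk : x ≤ fuel
    xk = ≤-trans (≤-trans (m≤m+n x (suc y)) (≤-reflexive (sym kxy))) kf
    yk : y ≤ fuel
    yk = ≤-trans (≤-trans (≤-trans (n≤1+n y) (m≤n+m (suc y) x)) (≤-reflexive (sym kxy))) kf
    IH1 : Dyck (slice w (suc l) x)
    IH1 = closed-Dyck fuel (suc l) x xk (≤-trans (≤-reflexive (sym p≡)) (≤-trans pN (n≤1+n N)))
            (subst (Closed (suc l)) p≡ (arc-closed lp'))
    IH2 : Dyck (slice w p y)
    IH2 = closed-Dyck fuel p y yk (≤-trans (≤-reflexive re) rN) (subst (Closed p) (sym re) (closed-split cl lp' pr))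
    goal : Dyck (slice w l (suc k))
    goal rewrite split1 | split2 | lt1 | lt2 = nest IH1 IH2

  arc-length : ∀ {a b} → W a b → ∃[ k ] b ≡ a + suc k
  arc-length {a} {b} ab with m≤n⇒∃[o]m+o≡n (proj₁ (proj₂ (bounds ab)))
  ... | k , e = k , trans (sym e) (sym (+-suc a k))

  arc-Dyck : ∀ {a k} → W a (a + suc k) → Dyck (slice w a k)
  arc-Dyck {a} {k} ab = closed-Dyck k a k ≤-refl (≤-trans (proj₂ (proj₂ (bounds ab))) (n≤1+n N)) (arc-closed ab)

  Dyck-arc : ∀ a k → 1 ≤ a → a + suc k ≤ N → at w (pred a) ≡ true → Dyck (slice w a k) → at w (a + k) ≡ false → W a (a + suc k)
  Dyck-arc (suc i) k _ aN la dk lb with left-arc i (≤-trans (s≤s (m≤m+n i (suc k))) aN) la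
  ... | b , ab with arc-length ab
  ... | k' , refl with <-cmp k' k
  ... | tri≈ _ refl _ = ab
  ... | tri< k'<k _ _ = ⊥-elim (Dyck⇒¬Dyck-++-false∷ dk' (subst Dyck e dk))
    where
    a = suc i
    dk' = arc-Dyck ab
    lb' : at w (a + k') ≡ false
    lb' = subst (λ z → at w (pred z) ≡ false) (+-suc a k') (right-letter ab)
    y = proj₁ (m≤n⇒∃[o]m+o≡n k'<k)
    ey : suc k' + y ≡ k
    ey = proj₂ (m≤n⇒∃[o]m+o≡n k'<k)
    e : slice w a k ≡ slice w a k' ++ false ∷ slice w (suc (a + k')) y
    e =
      trans (cong (slice w a) (trans (sym ey) (sym (+-suc k' y)))) (trans (slice-split w a k' y (subst (a + k' <_) (sym lenw) (≤-trans (+-monoʳ-< a (s≤s (<⇒≤ k'<k))) aN)))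
          (cong (λ z → slice w a k' ++ z ∷ slice w (suc (a + k')) y) lb'))
  ... | tri> _ _ k<k' = ⊥-elim (Dyck⇒¬Dyck-++-false∷ dk (subst Dyck e (arc-Dyck ab)))
    where
    a = suc i
    y = proj₁ (m≤n⇒∃[o]m+o≡n k<k')
    ey : suc k + y ≡ k'
    ey = proj₂ (m≤n⇒∃[o]m+o≡n k<k')
    bN : a + suc k' ≤ N
    bN = proj₂ (proj₂ (bounds ab))
    e : slice w a k' ≡ slice w a k ++ false ∷ slice w (suc (a + k)) y
    e =
      trans (cong (slice w a) (trans (sym ey) (sym (+-suc k y)))) (trans (slice-split w a k y (subst (a + k <_) (sym lenw) (≤-trans (+-monoʳ-< a (s≤s (<⇒≤ k<k'))) bN)))
          (cong (λ z → slice w a k ++ z ∷ slice w (suc (a + k)) y) lb))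

  at-sym : ∀ i → i < N → at w i ≡ not (at w (N ∸ suc i))
  at-sym i lt = trans (cong (λ z → at z i) symw) (trans (at-revCompl w i (subst (i <_) (sym lenw) lt)) (cong (λ z → not (at w (z ∸ suc i))) lenw))

  bar-suc : ∀ m → m ≤ N → N + 1 ∸ m ≡ suc (N ∸ m)
  bar-suc m le = trans (+-∸-comm 1 le) (+-comm (N ∸ m) 1)

  N∸bar-suc : ∀ m → 1 ≤ m → m ≤ N → N ∸ suc (N ∸ m) ≡ pred m
  N∸bar-suc m _ le = trans (sym (pred[m∸n]≡m∸[1+n] N (N ∸ m))) (cong pred (m∸[m∸n]≡n le))

  at-mirror : ∀ m → 1 ≤ m → m ≤ N → at w (N ∸ m) ≡ not (at w (pred m))
  at-mirror m o le = trans (at-sym (N ∸ m) (≤-trans (∸-monoʳ-< {N} {m} {0} o le) (≤-reflexive (refl)))) (cong (λ z → not (at w z)) (N∸bar-suc m o le))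

  slice-mirror : ∀ a k c → a + suc k + c ≡ N → slice w (suc c) k ≡ revCompl (slice w a k)
  slice-mirror a k c e = begin
      slice w (suc c) k
    ≡⟨ cong (λ z → slice z (suc c) k) symw ⟩
      slice (revCompl w) (suc c) k
    ≡⟨ cong (λ z → slice (revCompl z) (suc c) k) wsplit ⟩
      slice (revCompl (A ++ (S ++ B))) (suc c) k
    ≡⟨ cong (λ z → slice z (suc c) k) rcsplit ⟩
      slice (revCompl B ++ (revCompl S ++ revCompl A)) (suc c) k
    ≡⟨ cong (λ z → slice (revCompl B ++ (revCompl S ++ revCompl A)) z k) (sym lrcB) ⟩
      slice (revCompl B ++ (revCompl S ++ revCompl A)) (length (revCompl B)) k
    ≡⟨ slice-++ (revCompl B) (revCompl S ++ revCompl A) k ⟩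
      take k (revCompl S ++ revCompl A)
    ≡⟨ take-++-length (revCompl S) (revCompl A) k (trans (length-revCompl S) lS) ⟩
      revCompl S ∎
    where
    open ≡-Reasoning
    A = take a w
    S = slice w a k
    B = drop k (drop a w)
    wsplit : w ≡ A ++ (S ++ B)
    wsplit = trans (sym (take++drop≡id a w)) (cong (A ++_) (sym (take++drop≡id k (drop a w))))
    rcsplit : revCompl (A ++ (S ++ B)) ≡ revCompl B ++ (revCompl S ++ revCompl A)
    rcsplit = trans (revCompl-++ A (S ++ B)) (trans (cong (_++ revCompl A) (revCompl-++ S B)) (++-assoc (revCompl B) (revCompl S) (revCompl A)))
    Na : N ∸ a ≡ suc c + k
    Na =
      trans (cong (_∸ a) (sym e)) (trans (cong (_∸ a) (trans (+-comm (a + suc k) c) (trans (sym (+-assoc c a (suc k))) (trans (cong (_+ suc k) (+-comm c a)) (+-assoc a c (suc k)))))) (trans (m+n∸m≡n a (c + suc k)) (+-suc c k)))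
    ldrop : length (drop a w) ≡ suc c + k
    ldrop = trans (LP.length-drop a w) (trans (cong (_∸ a) lenw) Na)
    lS : length S ≡ k
    lS = length-take-≤ k (drop a w) (subst (k ≤_) (sym ldrop) (m≤n+m k (suc c)))
    lrcB : length (revCompl B) ≡ suc c
    lrcB = trans (length-revCompl B) (trans (LP.length-drop k (drop a w)) (trans (cong (_∸ k) ldrop) (m+n∸n≡m (suc c) k)))

  arc-mirror : ∀ {a b} → W a b → W (N + 1 ∸ b) (N + 1 ∸ a)
  arc-mirror {a} {b} ab with arc-length ab
  ... | k , refl = subst₂ W (sym (bar-suc b bN)) (sym eA) (Dyck-arc (suc c) k (s≤s z≤n) cN l1 dy l2)
    where
    bN = proj₂ (proj₂ (bounds ab))
    a1 = proj₁ (bounds ab)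
    c = N ∸ b
    ec : a + suc k + c ≡ N
    ec = trans (+-comm (a + suc k) c) (m∸n+n≡m bN)
    Na : N ∸ a ≡ c + suc k
    Na = trans (cong (_∸ a) (sym ec)) (trans (cong (_∸ a) (trans (+-assoc a (suc k) c) (cong (a +_) (+-comm (suc k) c)))) (m+n∸m≡n a (c + suc k)))
    eA : N + 1 ∸ a ≡ suc c + suc k
    eA = trans (bar-suc a (≤-trans (m≤m+n a (suc k)) bN)) (cong suc Na)
    cN : suc c + suc k ≤ N
    cN = subst (_≤ N) (cong suc Na) (∸-monoʳ-< {N} {a} {0} a1 (≤-trans (m≤m+n a (suc k)) bN))
    l1 : at w (pred (suc c)) ≡ true
    l1 = trans (at-mirror b (≤-trans a1 (≤-trans (m≤m+n a (suc k)) ≤-refl)) bN) (cong not (right-letter ab))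
    l2 : at w (suc c + k) ≡ false
    l2 = trans (cong (at w) (trans (sym (+-suc c k)) (sym Na))) (trans (at-mirror a a1 (≤-trans (m≤m+n a (suc k)) bN)) (cong not (left-letter ab)))
    dy : Dyck (slice w (suc c) k)
    dy = subst Dyck (sym (slice-mirror a k c ec)) (Dyck-revCompl (arc-Dyck ab))


module FoldWindow where

  open BallotWord
  open DyckWords
  open Positions using (at-++-length)

  windowLetter : ℕ → List Bool → Bool
  windowLetter i M = at (rectify (height 0 (inner i M)) (drop (suc (2 * i)) M)) 0

  length-drop-window : ∀ i (M : List Bool) → length M ≡ 2 * suc i → length (drop (suc (2 * i)) M) ≡ 1
  length-drop-window i M e =
    trans (LP.length-drop (suc (2 * i)) M) (trans (cong (_∸ suc (2 * i)) e) (trans (cong (_∸ suc (2 * i)) (ar i)) (m+n∸m≡n (suc (2 * i)) 1)))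
    where
    ar : ∀ i → 2 * suc i ≡ suc (2 * i) + 1
    ar = solve-∀

  length-foldWord : ∀ m s → length s ≡ 2 * m → length (foldWord m s) ≡ 2 * m
  length-foldWord zero s _ = refl
  length-foldWord (suc m) s e = begin
      length (foldWord m (inner m s) ++ rectify c L ++ [ promotedLetter s ])
    ≡⟨ length-++ (foldWord m (inner m s)) ⟩
      length (foldWord m (inner m s)) + length (rectify c L ++ [ promotedLetter s ])
    ≡⟨ cong₂ _+_ (length-foldWord m (inner m s) (length-inner m s e)) (trans (length-++ (rectify c L)) (cong (_+ 1) (trans (length-rectify c L) (length-drop-window m s e)))) ⟩
      2 * m + (1 + 1)
    ≡⟨ ar m ⟩
      2 * suc m ∎
    where
    open ≡-Reasoning
    c = height 0 (inner m s)
    L = drop (suc (2 * m)) s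
    ar : ∀ m → 2 * m + (1 + 1) ≡ 2 * suc m
    ar = solve-∀

  foldWord-last-letters : ∀ i M → length M ≡ 2 * suc i →
    at (foldWord (suc i) M) (2 * i) ≡ windowLetter i M × at (foldWord (suc i) M) (suc (2 * i)) ≡ promotedLetter M
  foldWord-last-letters i M eM = at-2i , at-2i+1
    where
    Pg = foldWord i (inner i M)
    c = height 0 (inner i M)
    L = drop (suc (2 * i)) M
    lP : length Pg ≡ 2 * i
    lP = length-foldWord i (inner i M) (length-inner i M eM)
    lR : length (rectify c L) ≡ 1
    lR = trans (length-rectify c L) (length-drop-window i M eM)
    at-2i : at (Pg ++ rectify c L ++ [ promotedLetter M ]) (2 * i) ≡ windowLetter i M
    at-2i = trans (subst (λ z → at (Pg ++ rectify c L ++ [ promotedLetter M ]) z ≡ at (rectify c L ++ [ promotedLetter M ]) 0) lP (at-++-length Pg _))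
               (at-++ˡ (rectify c L) [ promotedLetter M ] 0 (subst (0 <_) (sym lR) (s≤s z≤n)))
    at-2i+1 : at (Pg ++ rectify c L ++ [ promotedLetter M ]) (suc (2 * i)) ≡ promotedLetter M
    at-2i+1 =
      trans (subst (λ z → at (Pg ++ rectify c L ++ [ promotedLetter M ]) z ≡ at (rectify c L ++ [ promotedLetter M ]) 1) (trans (cong (_+ 1) lP) (+-comm (2 * i) 1)) (at-++ʳ Pg _ 1))
               (subst (λ z → at (rectify c L ++ [ promotedLetter M ]) z ≡ promotedLetter M) lR (at-++-length (rectify c L) [ promotedLetter M ]))

  -- Letters 2i and 2i+1 of the folded word are written when the window M of length 2i+2 in
  -- the middle of the word is promoted; the outer letters of A and B are peeled off first.
  foldWord-window : ∀ d i (A M B : List Bool) → length A ≡ d → length B ≡ d → length M ≡ 2 * suc i →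
     at (foldWord (d + suc i) (A ++ M ++ B)) (2 * i) ≡ windowLetter i M × at (foldWord (d + suc i) (A ++ M ++ B)) (suc (2 * i)) ≡ promotedLetter M
  foldWord-window zero i [] M [] _ _ eM rewrite ++-identityʳ M = foldWord-last-letters i M eM
  foldWord-window (suc d) i (a ∷ A) M B eA eB eM with snoc-view B d eB
  ... | B' , b , refl , eB' = at-2i , at-2i+1
    where
    k = d + suc i
    s = a ∷ A ++ M ++ B' ++ [ b ]
    core = A ++ M ++ B'
    lcore : length core ≡ 2 * k
    lcore =
      trans (length-++ A) (trans (cong (length A +_) (length-++ M)) (trans (cong₂ (λ x y → x + (length M + y)) (suc-injective eA) eB') (trans (cong (λ z → d + (z + d)) eM) (ar d i))))
      where
      ar : ∀ d i → d + (2 * suc i + d) ≡ 2 * (d + suc i)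
      ar = solve-∀
    sEq : A ++ M ++ B' ++ [ b ] ≡ core ++ [ b ]
    sEq = trans (cong (A ++_) (sym (++-assoc M B' [ b ]))) (sym (++-assoc A (M ++ B') [ b ]))
    midEq : inner k s ≡ core
    midEq = trans (cong (take (2 * k)) sEq) (take-++-length core [ b ] (2 * k) lcore)
    IH = foldWord-window d i A M B' (suc-injective eA) eB' eM
    c = height 0 (inner k s)
    L = drop (suc (2 * k)) s
    lG : length (foldWord k (inner k s)) ≡ 2 * k
    lG = length-foldWord k (inner k s) (trans (cong length midEq) lcore)
    lt2 : suc (2 * i) < length (foldWord k (inner k s))
    lt2 = subst (suc (2 * i) <_) (sym lG) (≤-trans (≤-reflexive (ar1 i)) (*-monoʳ-≤ 2 (m≤n+m (suc i) d)))
      where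
      ar1 : ∀ i → suc (suc (2 * i)) ≡ 2 * suc i
      ar1 = solve-∀
    lt1 : 2 * i < length (foldWord k (inner k s))
    lt1 = ≤-trans (n≤1+n _) lt2
    Q = rectify c L ++ [ promotedLetter s ]
    at-2i : at (foldWord (suc k) s) (2 * i) ≡ windowLetter i M
    at-2i = trans (at-++ˡ (foldWord k (inner k s)) Q (2 * i) lt1) (trans (cong (λ z → at (foldWord k z) (2 * i)) midEq) (proj₁ IH))
    at-2i+1 : at (foldWord (suc k) s) (suc (2 * i)) ≡ promotedLetter M
    at-2i+1 = trans (at-++ˡ (foldWord k (inner k s)) Q (suc (2 * i)) lt2) (trans (cong (λ z → at (foldWord k z) (suc (2 * i))) midEq) (proj₂ IH))


module WindowLetters (n : ℕ) (w : List Bool) (lenw : length w ≡ 2 * n) (symw : w ≡ DyckWords.revCompl w)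
                     (W : Web) (isW : IsWebOf n (Tableaux.tableau w) W) where

  open BallotWord
  open DyckWords
  open Positions
  open FoldWindow
  open WebOfWord n w lenw symw W isW

  open IsWebOf isW
  open Is2Web isWeb

  folded : List Bool
  folded = foldWord n w

  -- Vertex j = d+1 ≤ n and its mirror j̄ = N+1-j bound the window M of the letters of
  -- vertices j, …, j̄.  Folding sends them to the vertices 2i+1 and 2i+2, whose letters are
  -- those at 2i and 2i+1 in the folded word.
  module Window (d i : ℕ) (e : n ≡ d + suc i) where
    C = slice w (suc d) (2 * i)
    l = at w (suc d + 2 * i)
    M = slice w d (2 * suc i)
    NE : N ≡ d + 2 * suc i + d
    NE = trans (cong (2 *_) e) (ar d i)
      where
      ar : ∀ d i → 2 * (d + suc i) ≡ d + 2 * suc i + d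
      ar = solve-∀
    lenM : length M ≡ 2 * suc i
    lenM =
      length-take-≤ (2 * suc i) (drop d w) (subst (2 * suc i ≤_) (sym (trans (LP.length-drop d w) (trans (cong (_∸ d) (trans lenw NE)) (ar d i)))) (m≤m+n (2 * suc i) d))
      where
      ar : ∀ d i → d + 2 * suc i + d ∸ d ≡ 2 * suc i + d
      ar d i = ≡+⇒∸≡ (+-assoc d (2 * suc i) d)
    A = take d w
    B = drop (d + 2 * suc i) w
    wEq : w ≡ A ++ M ++ B
    wEq =
      trans (sym (take++drop≡id d w)) (cong (A ++_) (trans (sym (take++drop≡id (2 * suc i) (drop d w))) (cong (M ++_) (LP.drop-drop d (2 * suc i) w))))
    dN : d ≤ length w
    dN = subst (d ≤_) (sym (trans lenw NE)) (m≤n+m d _)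
    lA : length A ≡ d
    lA = length-take-≤ d w dN
    lB : length B ≡ d
    lB = trans (LP.length-drop (d + 2 * suc i) w) (≡+⇒∸≡ (trans lenw NE))
    window = foldWord-window d i A M B lA lB lenM
    g1 : at folded (2 * i) ≡ windowLetter i M
    g1 =
      subst (λ z → at (foldWord z w) (2 * i) ≡ windowLetter i M) (sym e) (subst (λ z → at (foldWord (d + suc i) z) (2 * i) ≡ windowLetter i M) (sym wEq) (proj₁ window))
    g2 : at folded (suc (2 * i)) ≡ promotedLetter M
    g2 =
      subst (λ z → at (foldWord z w) (suc (2 * i)) ≡ promotedLetter M) (sym e) (subst (λ z → at (foldWord (d + suc i) z) (suc (2 * i)) ≡ promotedLetter M) (sym wEq) (proj₂ window))
    NE2 : N ≡ suc (suc d + 2 * i) + d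
    NE2 = trans NE (ar d i)
      where
      ar : ∀ d i → d + 2 * suc i + d ≡ suc (suc d + 2 * i) + d
      ar = solve-∀
    lt-l : suc d + 2 * i < length w
    lt-l = subst (suc d + 2 * i <_) (sym (trans lenw NE2)) (m≤m+n _ d)
    lt-d : d + 0 < length w
    lt-d = ≤-trans (s≤s (≤-trans (≤-reflexive (+-identityʳ d)) (≤-trans (n≤1+n d) (m≤m+n (suc d) (2 * i))))) lt-l
    NmJ : N ∸ suc d ≡ suc d + 2 * i
    NmJ = ≡+⇒∸≡ {y = suc d} (trans NE2 (ar d i))
      where
      ar : ∀ d i → suc (suc d + 2 * i) + d ≡ suc d + (suc d + 2 * i)
      ar = solve-∀
    lenC : length C ≡ 2 * i
    lenC =
      length-take-≤ (2 * i) (drop (suc d) w) (subst (2 * i ≤_) (sym (trans (LP.length-drop (suc d) w) (trans (cong (_∸ suc d) lenw) NmJ))) (m≤n+m (2 * i) (suc d)))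
    Mstruct : M ≡ at w d ∷ C ++ [ l ]
    Mstruct = trans (cong (slice w d) (ar i)) (trans (slice-split w d 0 (2 * i + 1) lt-d)
                (trans (cong (λ z → at w z ∷ slice w (suc z) (2 * i + 1)) (+-identityʳ d))
                  (cong (at w d ∷_) (trans (slice-split w (suc d) (2 * i) 0 lt-l) refl))))
      where
      ar : ∀ i → 2 * suc i ≡ suc (2 * i + 1)
      ar = solve-∀
    midM : inner i M ≡ C
    midM = trans (cong (inner i) Mstruct) (take-++-length C [ l ] (2 * i) lenC)
    dropM : drop (suc (2 * i)) M ≡ [ l ]
    dropM = trans (cong (drop (suc (2 * i))) Mstruct) (subst (λ z → drop z (C ++ [ l ]) ≡ [ l ]) lenC (drop-length-++ C [ l ]))
    letter-2i : at folded (2 * i) ≡ rectifyLetter (height 0 C) l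
    letter-2i = trans g1 (trans (cong₂ (λ a b → at (rectify (height 0 a) b) 0) midM dropM) (rectifyLetter-at (height 0 C) l))
    letter-2i+1 : at folded (suc (2 * i)) ≡ promotedLetter (at w d ∷ C ++ [ l ])
    letter-2i+1 = trans g2 (cong promotedLetter Mstruct)
    jN : suc d ≤ N
    jN = subst (suc d ≤_) (sym NE2) (≤-trans (≤-trans (n≤1+n (suc d)) (s≤s (m≤m+n (suc d) (2 * i)))) (m≤m+n _ d))
    lEq : l ≡ not (at w d)
    lEq = trans (cong (at w) (sym NmJ)) (at-mirror (suc d) (s≤s z≤n) jN)
    jbar : N + 1 ∸ suc d ≡ suc d + suc (2 * i)
    jbar = ≡+⇒∸≡ {y = suc d} (trans (cong (_+ 1) NE2) (ar d i))
      where
      ar : ∀ d i → suc (suc d + 2 * i) + d + 1 ≡ suc d + (suc d + suc (2 * i))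
      ar = solve-∀
    letters-right : at w d ≡ false → at folded (2 * i) ≡ true × at folded (suc (2 * i)) ≡ true
    letters-right h =
      trans letter-2i (cong (rectifyLetter (height 0 C)) (trans lEq (cong not h))) ,
      trans letter-2i+1 (cong (λ b → promotedLetter (b ∷ C ++ [ l ])) h)
    closes-at-j̄ : ∀ {b} → W (suc d) b → l ≡ false
    closes-at-j̄ ab = trans lEq (cong not (left-letter ab))
    letters-axis : W (suc d) (N + 1 ∸ suc d) → at folded (2 * i) ≡ true × at folded (suc (2 * i)) ≡ false
    letters-axis ab =
      trans letter-2i (cong₂ rectifyLetter (proj₂ (Dyck-rectify dyC 0)) (closes-at-j̄ ab)) ,
      trans letter-2i+1 (trans (cong₂ (λ b c → promotedLetter (b ∷ C ++ [ c ])) (left-letter ab) (closes-at-j̄ ab)) (cong not (Dyck-hitsFloor dyC 0 [ false ])))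
      where
      dyC : Dyck C
      dyC = arc-Dyck (subst (W (suc d)) jbar ab)
    letter-2i+1-left : ∀ {k} → W (suc d) (suc d + suc k) → k < 2 * i → at folded (suc (2 * i)) ≡ false
    letter-2i+1-left {k} ab k<2i =
      trans letter-2i+1 (trans (cong₂ (λ b c → promotedLetter (b ∷ C ++ [ c ])) (left-letter ab) (closes-at-j̄ ab))
        (cong not (trans (cong (λ z → hitsFloor 0 (z ++ [ false ])) Csplit)
          (trans (cong (hitsFloor 0) (++-assoc (slice w (suc d) k) _ [ false ])) (Dyck-hitsFloor dk 0 _)))))
      where
      y = proj₁ (m≤n⇒∃[o]m+o≡n k<2i)
      ey : suc k + y ≡ 2 * i
      ey = proj₂ (m≤n⇒∃[o]m+o≡n k<2i)
      dk : Dyck (slice w (suc d) k)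
      dk = arc-Dyck ab
      rgt : at w (suc d + k) ≡ false
      rgt = subst (λ z → at w (pred z) ≡ false) (+-suc (suc d) k) (right-letter ab)
      Csplit : C ≡ slice w (suc d) k ++ false ∷ slice w (suc (suc d + k)) y
      Csplit = trans (cong (slice w (suc d)) (trans (sym ey) (sym (+-suc k y))))
                 (trans (slice-split w (suc d) k y (≤-trans (+-monoʳ-< (suc d) k<2i) (<⇒≤ lt-l)))
                   (cong (λ z → slice w (suc d) k ++ z ∷ slice w (suc (suc d + k)) y) rgt))

    -- The mirror arc of {j, b} opens inside C and closes only at j̄, so C has positive height.
    letter-2i-left : ∀ {k} → W (suc d) (suc d + suc k) → suc d + suc k < N + 1 ∸ suc d → at folded (2 * i) ≡ false
    letter-2i-left {k} ab bj = trans letter-2i (cong₂ rectifyLetter height-C (closes-at-j̄ ab))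
      where
      bb′ = suc d + suc k
      mab : W (N + 1 ∸ bb′) (N + 1 ∸ suc d)
      mab = arc-mirror ab
      bN : bb′ ≤ N
      bN = proj₂ (proj₂ (bounds ab))
      bb : (N + 1 ∸ bb′) + bb′ ≡ suc d + (N + 1 ∸ suc d)
      bb = trans (m∸n+n≡m (≤-trans bN (m≤m+n N 1))) (trans (sym (m∸n+n≡m (≤-trans jN (m≤m+n N 1)))) (+-comm _ (suc d)))
      j<b̄ : suc d < N + 1 ∸ bb′
      j<b̄ = +-≡-<-swap bb bj
      x = proj₁ (m≤n⇒∃[o]m+o≡n j<b̄)
      ex : suc (suc d) + x ≡ N + 1 ∸ bb′
      ex = proj₂ (m≤n⇒∃[o]m+o≡n j<b̄)
      mab' : W (suc (suc d + x)) (N + 1 ∸ suc d)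
      mab' = subst (λ z → W z (N + 1 ∸ suc d)) (sym ex) mab
      k2 = proj₁ (arc-length mab')
      ek2 : N + 1 ∸ suc d ≡ suc (suc d + x) + suc k2
      ek2 = proj₂ (arc-length mab')
      e2i : 2 * i ≡ x + suc k2
      e2i = suc-injective (+-cancelˡ-≡ (suc d) _ _ (trans (sym jbar) (trans ek2 (ar d x k2))))
        where
        ar : ∀ d x k2 → suc (suc d + x) + suc k2 ≡ suc d + suc (x + suc k2)
        ar = solve-∀
      mab'' : W (suc (suc d + x)) (suc (suc d + x) + suc k2)
      mab'' = subst (W (suc (suc d + x))) ek2 mab'
      x<2i : x < 2 * i
      x<2i = subst (x <_) (sym e2i) (subst (x <_) (sym (+-suc x k2)) (s≤s (m≤m+n x k2)))
      Csplit : C ≡ slice w (suc d) x ++ true ∷ slice w (suc (suc d + x)) k2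
      Csplit = trans (cong (slice w (suc d)) e2i)
                  (trans (slice-split w (suc d) x k2 (≤-trans (+-monoʳ-< (suc d) x<2i) (<⇒≤ lt-l)))
                    (cong (λ z → slice w (suc d) x ++ z ∷ slice w (suc (suc d + x)) k2) (left-letter mab'')))
      height-C : height 0 C ≡ suc (height 0 (slice w (suc d) x))
      height-C = trans (cong (height 0) Csplit) (trans (height-++ 0 (slice w (suc d) x) _) (proj₂ (Dyck-rectify (arc-Dyck mab'') _)))

    letters-left : ∀ {b} → W (suc d) b → b < N + 1 ∸ suc d → at folded (2 * i) ≡ false × at folded (suc (2 * i)) ≡ false
    letters-left {b} ab bj with arc-length ab
    ... | k , refl = letter-2i-left ab bj ,
      letter-2i+1-left ab (≤-pred (+-cancelˡ-< (suc d) (suc k) (suc (2 * i)) (subst (suc d + suc k <_) jbar bj)))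

module FoldedWeb (n : ℕ) (w : List Bool) (lenw : length w ≡ 2 * n) (symw : w ≡ DyckWords.revCompl w)
                 (W : Web) (isW : IsWebOf n (Tableaux.tableau w) W) where

  open BallotWord
  open Slide using (firstRow; secondRow)
  open Tableaux
  open DyckWords
  open Positions
  open FoldWindow
  open WebOfWord n w lenw symw W isW
  open WindowLetters n w lenw symw W isW

  open IsWebOf isW
  open Is2Web isWeb

  oddPos evenPos : ℕ → ℕ
  oddPos i = suc (2 * i)
  evenPos i = suc (suc (2 * i))

  fold-positions : ∀ d i → n ≡ d + suc i → (N + 1 ∸ 2 * suc d ≡ oddPos i) × (N + 2 ∸ 2 * suc d ≡ evenPos i)
  fold-positions d i e =
    ≡+⇒∸≡ {y = 2 * suc d} (trans (cong (λ z → 2 * z + 1) e) (ar1 d i)) , ≡+⇒∸≡ {y = 2 * suc d} (trans (cong (λ z → 2 * z + 2) e) (ar2 d i))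
    where
    ar1 : ∀ d i → 2 * (d + suc i) + 1 ≡ 2 * suc d + suc (2 * i)
    ar1 = solve-∀
    ar2 : ∀ d i → 2 * (d + suc i) + 2 ≡ 2 * suc d + suc (suc (2 * i))
    ar2 = solve-∀

  ≤n-offset : ∀ j → 1 ≤ j → j ≤ n → ∃[ d ] ∃[ i ] (j ≡ suc d × n ≡ d + suc i)
  ≤n-offset (suc d) _ le with m≤n⇒∃[o]m+o≡n le
  ... | i , e = d , i , refl , trans (sym e) (sym (+-suc d i))

  <n-offset : ∀ i → i < n → ∃[ d ] n ≡ d + suc i
  <n-offset i lt with m≤n⇒∃[o]m+o≡n lt
  ... | d , e = d , trans (sym e) (+-comm (suc i) d)

  offset-anti : ∀ {d i d' i'} → n ≡ d + suc i → n ≡ d' + suc i' → i < i' → d' < d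
  offset-anti {d} {i} {d'} {i'} e e' lt = +-≡-<-swap (trans (sym e) e') (s≤s lt)

  index-anti : ∀ {d i d' i'} → n ≡ d + suc i → n ≡ d' + suc i' → d < d' → i' < i
  index-anti {d} {i} {d'} {i'} e e' lt = ≤-pred (+-≡-<-swap (trans (+-comm (suc i) d) (trans (sym e) (trans e' (+-comm d' (suc i'))))) lt)

  offset-≡ : ∀ {d i d' i'} → n ≡ d + suc i → n ≡ d' + suc i' → i ≡ i' → d ≡ d'
  offset-≡ {d} {i} {d'} e e' refl = +-cancelʳ-≡ (suc i) d d' (trans (sym e) e')

  index-≡ : ∀ {d i d' i'} → n ≡ d + suc i → n ≡ d' + suc i' → d ≡ d' → i ≡ i'
  index-≡ {d} e e' refl = suc-injective (+-cancelˡ-≡ d _ _ (trans (sym e) e'))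

  -- An arc {n - q, n - p} of W with p < q is recorded as FoldedPair p q, and an arc joining
  -- n - q to its mirror as AxisArc q; fold-positions places n - i at 2i+1 and 2i+2.
  FoldedPair : ℕ → ℕ → Set
  FoldedPair p q = ∃[ da ] ∃[ db ] (n ≡ da + suc q × n ≡ db + suc p × W (suc da) (suc db))

  AxisArc : ℕ → Set
  AxisArc q = ∃[ da ] (n ≡ da + suc q × W (suc da) (N + 1 ∸ suc da))

  data FoldArc (x y : ℕ) : Set where
    evenOdd : ∀ p q → p < q → q < n → FoldedPair p q → x ≡ evenPos p → y ≡ oddPos q → FoldArc x y
    oddEven : ∀ p q → p < q → q < n → FoldedPair p q → x ≡ oddPos p → y ≡ evenPos q → FoldArc x y
    axis : ∀ q → q < n → AxisArc q → x ≡ oddPos q → y ≡ evenPos q → FoldArc x y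

  index<n : ∀ {d i} → n ≡ d + suc i → i < n
  index<n {d} {i} e = subst (i <_) (sym e) (≤-trans (n<1+n i) (m≤n+m (suc i) d))

  toFoldArc : ∀ {x y} → foldW n W x y → FoldArc x y
  toFoldArc (inj₁ (a , b , a<b , b≤n , ab , _ , opt)) with ≤n-offset a (proj₁ (bounds ab)) (≤-trans (<⇒≤ a<b) b≤n) | ≤n-offset b (≤-trans (s≤s z≤n) a<b) b≤n
  ... | da , q , refl , eq | db , p , refl , ep with opt
  ... | inj₁ (ex , ey) =
    evenOdd p q (index-anti eq ep (≤-pred a<b)) (index<n eq) (da , db , eq , ep , ab) (trans ex (proj₂ (fold-positions db p ep))) (trans ey (proj₁ (fold-positions da q eq)))
  ... | inj₂ (ex , ey) =
    oddEven p q (index-anti eq ep (≤-pred a<b)) (index<n eq) (da , db , eq , ep , ab) (trans ex (proj₁ (fold-positions db p ep))) (trans ey (proj₂ (fold-positions da q eq)))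
  toFoldArc (inj₂ (a , a≤n , ab , ex , ey)) with ≤n-offset a (proj₁ (bounds ab)) a≤n
  ... | da , q , refl , eq =
    axis q (index<n eq) (da , eq , ab) (trans ex (proj₁ (fold-positions da q eq))) (trans ey (proj₂ (fold-positions da q eq)))

  FoldedPair-nonCross : ∀ {p q p' q'} → FoldedPair p q → FoldedPair p' q' → p < p' → p' < q → q < q' → ⊥
  FoldedPair-nonCross (da , db , eq , ep , ab) (da' , db' , eq' , ep' , ab') pp' p'q qq' =
    nonCross (suc da') (suc db') (suc da) (suc db) ab' ab (s≤s (offset-anti eq eq' qq')) (s≤s (offset-anti ep' eq p'q)) (s≤s (offset-anti ep ep' pp'))

  FoldedPair-uniqueˡ : ∀ {p q p'} → FoldedPair p q → FoldedPair p' q → p ≡ p'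
  FoldedPair-uniqueˡ (da , db , eq , ep , ab) (da' , db' , eq' , ep' , ab') with offset-≡ eq eq' refl
  ... | refl = index-≡ ep ep' (suc-injective (unique (suc da) (suc db) (suc db') (inj₁ ab) (inj₁ ab')))

  FoldedPair-uniqueʳ : ∀ {p q q'} → FoldedPair p q → FoldedPair p q' → q ≡ q'
  FoldedPair-uniqueʳ (da , db , eq , ep , ab) (da' , db' , eq' , ep' , ab') with offset-≡ ep ep' refl
  ... | refl = index-≡ eq eq' (suc-injective (unique (suc db) (suc da) (suc da') (inj₂ ab) (inj₂ ab')))

  FoldedPair-noChain : ∀ {p q q'} → FoldedPair p q → FoldedPair q q' → ⊥
  FoldedPair-noChain (da , db , eq , ep , ab) (da' , db' , eq' , ep' , ab') with offset-≡ eq ep' refl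
  ... | refl =
    <-asym (proj₁ (proj₂ (bounds ab'))) (subst (suc da <_) (unique (suc da) (suc db) (suc da') (inj₁ ab) (inj₂ ab')) (proj₁ (proj₂ (bounds ab))))

  oddPos-cancel-< : ∀ {a b} → oddPos a < oddPos b → a < b
  oddPos-cancel-< {a} {b} lt = *-cancelˡ-< 2 a b (≤-pred lt)

  evenPos-cancel-< : ∀ {a b} → evenPos a < evenPos b → a < b
  evenPos-cancel-< {a} {b} lt = *-cancelˡ-< 2 a b (≤-pred (≤-pred lt))

  evenPos<oddPos⇒< : ∀ {a b} → evenPos a < oddPos b → a < b
  evenPos<oddPos⇒< {a} {b} lt = *-cancelˡ-< 2 a b (<-trans (n<1+n _) (≤-pred lt))

  oddPos<evenPos⇒≤ : ∀ {a b} → oddPos a < evenPos b → a ≤ b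
  oddPos<evenPos⇒≤ lt = *-cancelˡ-≤ 2 (≤-pred (≤-pred lt))

  no-position-between : ∀ {r x} → oddPos r < x → x < evenPos r → ⊥
  no-position-between a b = <-irrefl refl (≤-trans b a)

  FoldArc-nonCross : ∀ {x1 y1 x2 y2} → FoldArc x1 y1 → FoldArc x2 y2 → x1 < x2 → x2 < y1 → y1 < y2 → ⊥
  FoldArc-nonCross (axis r _ _ refl refl) f2 a b c = no-position-between {r} a b
  FoldArc-nonCross (evenOdd p q _ _ u refl refl) (axis r _ _ refl refl) a b c =
    <-irrefl refl (≤-trans (oddPos-cancel-< {r} {q} b) (oddPos<evenPos⇒≤ {q} {r} c))
  FoldArc-nonCross (oddEven p q _ _ u refl refl) (axis r _ _ refl refl) a b c =
    <-irrefl refl (≤-trans (s≤s (oddPos<evenPos⇒≤ {r} {q} b)) (evenPos-cancel-< {q} {r} c))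
  FoldArc-nonCross (evenOdd p q _ _ u refl refl) (evenOdd p' q' _ _ u' refl refl) a b c =
    FoldedPair-nonCross u u' (evenPos-cancel-< {p} {p'} a) (evenPos<oddPos⇒< {p'} {q} b) (oddPos-cancel-< {q} {q'} c)
  FoldArc-nonCross (evenOdd p q _ _ u refl refl) (oddEven p' q' _ _ u' refl refl) a b c with m≤n⇒m<n∨m≡n (oddPos<evenPos⇒≤ {q} {q'} c)
  ... | inj₁ qq' = FoldedPair-nonCross u u' (evenPos<oddPos⇒< {p} {p'} a) (oddPos-cancel-< {p'} {q} b) qq'
  ... | inj₂ refl = <-irrefl (FoldedPair-uniqueˡ u u') (evenPos<oddPos⇒< {p} {p'} a)
  FoldArc-nonCross (oddEven p q _ _ u refl refl) (evenOdd p' q' _ _ u' refl refl) a b c with m≤n⇒m<n∨m≡n (oddPos<evenPos⇒≤ {p} {p'} a)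
  ... | inj₁ pp' = FoldedPair-nonCross u u' pp' (evenPos-cancel-< {p'} {q} b) (evenPos<oddPos⇒< {q} {q'} c)
  ... | inj₂ refl = <-irrefl (FoldedPair-uniqueʳ u u') (evenPos<oddPos⇒< {q} {q'} c)
  FoldArc-nonCross (oddEven p q _ _ u refl refl) (oddEven p' q' _ _ u' refl refl) a b c with m≤n⇒m<n∨m≡n (oddPos<evenPos⇒≤ {p'} {q} b)
  ... | inj₁ p'q = FoldedPair-nonCross u u' (oddPos-cancel-< {p} {p'} a) p'q (evenPos-cancel-< {q} {q'} c)
  ... | inj₂ refl = FoldedPair-noChain u u'

  bar+≡ : ∀ m → m ≤ N → (N + 1 ∸ m) + m ≡ N + 1
  bar+≡ m le = m∸n+n≡m (≤-trans le (m≤m+n N 1))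

  offset<n : ∀ {d i} → n ≡ d + suc i → suc d ≤ n
  offset<n {d} {i} e = subst (suc d ≤_) (sym e) (subst (suc d ≤_) (sym (+-suc d i)) (s≤s (m≤m+n d i)))

  n≤N : n ≤ N
  n≤N = m≤m+n n (n + 0)

  n+n≡N : n + n ≡ N
  n+n≡N = cong (n +_) (sym (+-identityʳ n))

  n<bar : ∀ j → j ≤ n → n < N + 1 ∸ j
  n<bar j le = ≰⇒> (λ h → 1+n≰n (begin
      suc N
    ≡⟨ +-comm 1 N ⟩
      N + 1
    ≡⟨ sym (bar+≡ j (≤-trans le n≤N)) ⟩
      (N + 1 ∸ j) + j
    ≤⟨ +-mono-≤ h le ⟩
      n + n
    ≡⟨ n+n≡N ⟩
      N ∎))
    where open ≤-Reasoning

  bar-< : ∀ x y → x + y ≡ N + 1 → n < y → x < y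
  bar-< x y e n<y = ≰⇒> (λ y≤x → 1+n≰n (begin
      suc (N + 1)
    ≡⟨ ar n ⟩
      suc n + suc n
    ≤⟨ +-mono-≤ (≤-trans n<y y≤x) n<y ⟩
      x + y
    ≡⟨ e ⟩
      N + 1 ∎))
    where
    open ≤-Reasoning
    ar : ∀ n → suc (2 * n + 1) ≡ suc n + suc n
    ar = solve-∀

  -- A left endpoint j ≤ n is joined either to its mirror N+1-j or to a vertex b ≤ n:
  -- an arc {j, b} with n < b < N+1-j would cross its own mirror image.
  classify : ∀ d i → n ≡ d + suc i → (∃[ c ] W c (suc d)) ⊎ (W (suc d) (N + 1 ∸ suc d)) ⊎ (∃[ b ] (W (suc d) b × b < N + 1 ∸ suc d × b ≤ n))
  classify d i e with at w d in hl
  ... | false = inj₁ (right-arc d dN hl)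
    where
    dN : d < N
    dN = ≤-trans (offset<n e) n≤N
  ... | true with left-arc d (≤-trans (offset<n e) n≤N) hl
  ... | b , ab with <-cmp b (N + 1 ∸ suc d)
  ... | tri≈ _ refl _ = inj₂ (inj₁ ab)
  ... | tri< bj _ _ = inj₂ (inj₂ (b , ab , bj , b≤n))
    where
    j = suc d
    bN = proj₂ (proj₂ (bounds ab))
    bb : (N + 1 ∸ b) + b ≡ j + (N + 1 ∸ j)
    bb = trans (bar+≡ b bN) (trans (sym (bar+≡ j (≤-trans (offset<n e) n≤N))) (+-comm _ j))
    b≤n : b ≤ n
    b≤n with <-cmp n b
    ... | tri< nb _ _ = ⊥-elim (nonCross j b (N + 1 ∸ b) (N + 1 ∸ j) ab (arc-mirror ab) (+-≡-<-swap bb bj) (bar-< _ b (bar+≡ b bN) nb) bj)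
    ... | tri≈ _ refl _ = ≤-refl
    ... | tri> _ _ bn = <⇒≤ bn
  ... | tri> _ _ jb =
    ⊥-elim (nonCross (N + 1 ∸ b) (N + 1 ∸ j) j b (arc-mirror ab) ab (+-≡-<-swap jj jb) (≤-trans (s≤s (offset<n e)) (n<bar j (offset<n e))) jb)
    where
    j = suc d
    bN = proj₂ (proj₂ (bounds ab))
    jj : j + (N + 1 ∸ j) ≡ (N + 1 ∸ b) + b
    jj = trans (+-comm j _) (trans (bar+≡ j (≤-trans (offset<n e) n≤N)) (sym (bar+≡ b bN)))

  evenPos≡ : ∀ q → suc (suc (2 * q)) ≡ 2 * suc q
  evenPos≡ = solve-∀

  evenPos≤N : ∀ {q} → q < n → evenPos q ≤ N
  evenPos≤N {q} lt = subst (_≤ N) (sym (evenPos≡ q)) (*-monoʳ-≤ 2 lt)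

  oddPos<evenPos : ∀ q → oddPos q < evenPos q
  oddPos<evenPos q = ≤-refl

  fold-bounds : ∀ x y → foldW n W x y → 1 ≤ x × x < y × y ≤ N
  fold-bounds x y f with toFoldArc f
  ... | evenOdd p q p<q q<n _ refl refl =
    s≤s z≤n , s≤s (subst (_≤ 2 * q) (sym (evenPos≡ p)) (*-monoʳ-≤ 2 p<q)) , <⇒≤ (≤-trans (oddPos<evenPos q) (evenPos≤N q<n))
  ... | oddEven p q p<q q<n _ refl refl = s≤s z≤n , s≤s (s≤s (*-monoʳ-≤ 2 (<⇒≤ p<q))) , evenPos≤N q<n
  ... | axis q q<n _ refl refl = s≤s z≤n , oddPos<evenPos q , evenPos≤N q<n

  fold-nonCross : ∀ a b c d → foldW n W a b → foldW n W c d → a < c → c < b → b < d → ⊥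
  fold-nonCross a b c d f g = FoldArc-nonCross (toFoldArc f) (toFoldArc g)

  parity : ∀ q → ∃[ α ] (q ≡ 2 * α ⊎ q ≡ suc (2 * α))
  parity zero = 0 , inj₁ refl
  parity (suc q) with parity q
  ... | α , inj₁ refl = α , inj₂ refl
  ... | α , inj₂ refl = suc α , inj₁ (evenPos≡ α)

  parity<n : ∀ {q α} → q < N → (q ≡ 2 * α ⊎ q ≡ suc (2 * α)) → α < n
  parity<n {q} {α} lt (inj₁ refl) = *-cancelˡ-< 2 α n lt
  parity<n {q} {α} lt (inj₂ refl) = *-cancelˡ-< 2 α n (<-trans (n<1+n _) lt)

  -- A folded vertex is position b α for a unique parity b and index α, and its partner has the
  -- other parity and the index β of the partner of n - α in W (or β = α for an axis arc).
  Mate : ℕ → ℕ → Set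
  Mate α β = ∃[ d ] ∃[ dβ ] (n ≡ d + suc α × n ≡ dβ + suc β × (Partner W (suc d) (suc dβ) ⊎ (α ≡ β × W (suc d) (N + 1 ∸ suc d))))

  position : Bool → ℕ → ℕ
  position true = oddPos
  position false = evenPos

  Role : ℕ → ℕ → Set
  Role v u = ∃[ α ] ∃[ β ] ∃[ b ] (v ≡ position b α × u ≡ position (not b) β × Mate α β)

  role : ∀ {v u} → Partner (foldW n W) v u → Role v u
  role (inj₁ f) with toFoldArc f
  ... | evenOdd p q _ _ (da , db , eq , ep , ab) refl refl = p , q , false , refl , refl , db , da , ep , eq , inj₁ (inj₂ ab)
  ... | oddEven p q _ _ (da , db , eq , ep , ab) refl refl = p , q , true , refl , refl , db , da , ep , eq , inj₁ (inj₂ ab)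
  ... | axis q _ (da , eq , ab) refl refl = q , q , true , refl , refl , da , da , eq , eq , inj₂ (refl , ab)
  role (inj₂ f) with toFoldArc f
  ... | evenOdd p q _ _ (da , db , eq , ep , ab) refl refl = q , p , true , refl , refl , da , db , eq , ep , inj₁ (inj₁ ab)
  ... | oddEven p q _ _ (da , db , eq , ep , ab) refl refl = q , p , false , refl , refl , da , db , eq , ep , inj₁ (inj₁ ab)
  ... | axis q _ (da , eq , ab) refl refl = q , q , false , refl , refl , da , da , eq , eq , inj₂ (refl , ab)

  Mate-unique : ∀ {α β β'} → Mate α β → Mate α β' → β ≡ β'
  Mate-unique (d , dβ , e , eβ , m) (d' , dβ' , e' , eβ' , m') with offset-≡ e e' refl
  ... | refl with m | m'
  ... | inj₁ P | inj₁ P' = index-≡ eβ eβ' (suc-injective (unique (suc d) (suc dβ) (suc dβ') P P'))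
  ... | inj₁ P | inj₂ (refl , A) =
    ⊥-elim (<-irrefl (unique (suc d) (suc dβ) (N + 1 ∸ suc d) P (inj₁ A)) (≤-trans (s≤s (offset<n eβ)) (n<bar (suc d) (offset<n e))))
  ... | inj₂ (refl , A) | inj₁ P' =
    ⊥-elim (<-irrefl (unique (suc d) (suc dβ') (N + 1 ∸ suc d) P' (inj₁ A)) (≤-trans (s≤s (offset<n eβ')) (n<bar (suc d) (offset<n e))))
  ... | inj₂ (refl , _) | inj₂ (refl , _) = refl

  position-injective : ∀ b b' α α' → position b α ≡ position b' α' → b ≡ b' × α ≡ α'
  position-injective true true α α' e = refl , *-cancelˡ-≡ α α' 2 (suc-injective e)
  position-injective false false α α' e = refl , *-cancelˡ-≡ α α' 2 (suc-injective (suc-injective e))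
  position-injective true false α α' e = ⊥-elim (even≢odd α α' (suc-injective e))
  position-injective false true α α' e = ⊥-elim (even≢odd α' α (suc-injective (sym e)))

  fold-unique : ∀ v u u' → Partner (foldW n W) v u → Partner (foldW n W) v u' → u ≡ u'
  fold-unique v u u' P P' with role P | role P'
  ... | α , β , b , ev , eu , m | α' , β' , b' , ev' , eu' , m' with position-injective b b' α α' (trans (sym ev) ev')
  ... | refl , refl = trans eu (trans (cong (position (not b)) (Mate-unique m m')) (sym eu'))

  fold-evenOdd : ∀ {a b} → W a b → b ≤ n → foldW n W (N + 2 ∸ 2 * b) (N + 1 ∸ 2 * a)
  fold-evenOdd {a} {b} ab bn = inj₁ (a , b , proj₁ (proj₂ (bounds ab)) , bn , ab , arc-mirror ab , inj₁ (refl , refl))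

  fold-oddEven : ∀ {a b} → W a b → b ≤ n → foldW n W (N + 1 ∸ 2 * b) (N + 2 ∸ 2 * a)
  fold-oddEven {a} {b} ab bn = inj₁ (a , b , proj₁ (proj₂ (bounds ab)) , bn , ab , arc-mirror ab , inj₂ (refl , refl))

  fold-axis : ∀ {a} → a ≤ n → W a (N + 1 ∸ a) → foldW n W (N + 1 ∸ 2 * a) (N + 2 ∸ 2 * a)
  fold-axis {a} an A = inj₂ (a , an , A , refl , refl)

  length-folded : length folded ≡ N
  length-folded = length-foldWord n w lenw

  vertex-role : ∀ q → q < N →
    (∃[ y ] foldW n W (suc q) y × at folded q ≡ true) ⊎ (∃[ x ] foldW n W x (suc q) × at folded q ≡ false)
  vertex-role q q<N with parity q
  ... | α , pq with <n-offset α (parity<n q<N pq)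
  ... | d , e with fold-positions d α e | classify d α e | pq
  ... | o , ev | inj₁ (c , cj) | inj₁ refl = inj₁ (N + 2 ∸ 2 * c ,
    subst (λ z → foldW n W z (N + 2 ∸ 2 * c)) o (fold-oddEven cj (offset<n e)) ,
    proj₁ (Window.letters-right d α e (right-letter cj)))
  ... | o , ev | inj₁ (c , cj) | inj₂ refl = inj₁ (N + 1 ∸ 2 * c ,
    subst (λ z → foldW n W z (N + 1 ∸ 2 * c)) ev (fold-evenOdd cj (offset<n e)) ,
    proj₂ (Window.letters-right d α e (right-letter cj)))
  ... | o , ev | inj₂ (inj₁ A) | inj₁ refl = inj₁ (N + 2 ∸ 2 * suc d ,
    subst (λ z → foldW n W z (N + 2 ∸ 2 * suc d)) o (fold-axis (offset<n e) A) ,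
    proj₁ (Window.letters-axis d α e A))
  ... | o , ev | inj₂ (inj₁ A) | inj₂ refl = inj₂ (N + 1 ∸ 2 * suc d ,
    subst (foldW n W (N + 1 ∸ 2 * suc d)) ev (fold-axis (offset<n e) A) ,
    proj₂ (Window.letters-axis d α e A))
  ... | o , ev | inj₂ (inj₂ (b , jb , bj , bn)) | inj₁ refl = inj₂ (N + 2 ∸ 2 * b ,
    subst (foldW n W (N + 2 ∸ 2 * b)) o (fold-evenOdd jb bn) ,
    proj₁ (Window.letters-left d α e jb bj))
  ... | o , ev | inj₂ (inj₂ (b , jb , bj , bn)) | inj₂ refl = inj₂ (N + 1 ∸ 2 * b ,
    subst (foldW n W (N + 1 ∸ 2 * b)) ev (fold-oddEven jb bn) ,
    proj₂ (Window.letters-left d α e jb bj))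

  fold-covers : ∀ v → 1 ≤ v → v ≤ N → ∃[ u ] Partner (foldW n W) v u
  fold-covers (suc q) _ q<N with vertex-role q q<N
  ... | inj₁ (y , f , _) = y , inj₁ f
  ... | inj₂ (x , f , _) = x , inj₂ f

  fold-left⇒ : ∀ v → v ∈ firstRow (label 0 folded) → ∃[ y ] foldW n W v y
  fold-left⇒ v m with firstRow-label-∈ 0 folded v m
  ... | q , refl , q< , l with vertex-role q (subst (q <_) length-folded q<)
  ... | inj₁ (y , f , _) = y , f
  ... | inj₂ (_ , _ , l′) = ⊥-elim (true≢false (trans (sym l) l′))

  fold-right⇒ : ∀ v → v ∈ secondRow (label 0 folded) → ∃[ x ] foldW n W x v
  fold-right⇒ v m with secondRow-label-∈ 0 folded v m
  ... | q , refl , q< , l with vertex-role q (subst (q <_) length-folded q<)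
  ... | inj₁ (_ , _ , l′) = ⊥-elim (true≢false (trans (sym l′) l))
  ... | inj₂ (x , f , _) = x , f

  oddPos<length : ∀ {q} → q < n → suc (2 * q) < length folded
  oddPos<length {q} lt = subst (suc (2 * q) <_) (sym length-folded) (evenPos≤N lt)

  fold-left⇐ : ∀ v → ∃[ y ] foldW n W v y → v ∈ firstRow (label 0 folded)
  fold-left⇐ v (y , f) with toFoldArc f
  ... | evenOdd p q p<q q<n (da , db , eq , ep , ab) refl refl =
    ∈-firstRow-label 0 folded (suc (2 * p)) (oddPos<length (<-trans p<q q<n)) (proj₂ (Window.letters-right db p ep (right-letter ab)))
  ... | oddEven p q p<q q<n (da , db , eq , ep , ab) refl refl =
    ∈-firstRow-label 0 folded (2 * p) (<-trans (n<1+n _) (oddPos<length (<-trans p<q q<n))) (proj₁ (Window.letters-right db p ep (right-letter ab)))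
  ... | axis q q<n (da , eq , A) refl refl =
    ∈-firstRow-label 0 folded (2 * q) (<-trans (n<1+n _) (oddPos<length q<n)) (proj₁ (Window.letters-axis da q eq A))

  fold-right⇐ : ∀ v → ∃[ x ] foldW n W x v → v ∈ secondRow (label 0 folded)
  fold-right⇐ v (x , f) with toFoldArc f
  ... | evenOdd p q p<q q<n (da , db , eq , ep , ab) refl refl =
    ∈-secondRow-label 0 folded (2 * q) (<-trans (n<1+n _) (oddPos<length q<n)) (proj₁ (Window.letters-left da q eq ab bj))
    where
    bj : suc db < N + 1 ∸ suc da
    bj = ≤-trans (s≤s (offset<n ep)) (n<bar (suc da) (offset<n eq))
  ... | oddEven p q p<q q<n (da , db , eq , ep , ab) refl refl =
    ∈-secondRow-label 0 folded (suc (2 * q)) (oddPos<length q<n) (proj₂ (Window.letters-left da q eq ab bj))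
    where
    bj : suc db < N + 1 ∸ suc da
    bj = ≤-trans (s≤s (offset<n ep)) (n<bar (suc da) (offset<n eq))
  ... | axis q q<n (da , eq , A) refl refl = ∈-secondRow-label 0 folded (suc (2 * q)) (oddPos<length q<n) (proj₂ (Window.letters-axis da q eq A))

  isWebOf-folded : IsWebOf n (tableau folded) (foldW n W)
  isWebOf-folded = record
    { isWeb = record { arcBounds = fold-bounds ; covers = fold-covers ; unique = fold-unique ; nonCross = fold-nonCross }
    ; left = λ v → mk⇔ (fold-left⇒ v) (fold-left⇐ v)
    ; right = λ v → mk⇔ (fold-right⇒ v) (fold-right⇐ v)
    }


open Tableaux using (tableau)
open TableauWords using (F-tableau)
open Yamanouchi using (YamanouchiWord; yamanouchiWord)
open Evacuation using (selfComplementary)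

theorem1p1 : (n : ℕ) → 1 ≤ n → (T : Tab) → IsSYT n T → RotSym n T →
    (W : Web) → IsWebOf n T W → IsWebOf n (F n T) (foldW n W)
theorem1p1 n _ T syt rotSym W webOfT =
  subst (λ T′ → IsWebOf n T′ (foldW n W)) (sym F-T)
    (FoldedWeb.isWebOf-folded n w length-w (selfComplementary n T Y rotSym) W webOfW)
  where
  Y : YamanouchiWord n T
  Y = yamanouchiWord n T syt
  open YamanouchiWord Y
  webOfW : IsWebOf n (tableau w) W
  webOfW = subst (λ T′ → IsWebOf n T′ W) T≡tableau webOfT
  F-T : F n T ≡ tableau (BallotWord.foldWord n w)
  F-T = trans (cong (F n) T≡tableau) (F-tableau n w ballot length-w)
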